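{- Let $p$ be a prime, $n,n'\ge0$ integers, $K=K_p^{n+n'}$ the mirahoric subgroup of $\mathrm{GL}_4(\mathbb{Z}_p)$ of level $p^{n+n'}$, and $P$ the $(2,2)$ block upper triangular parabolic of $\mathrm{GL}_4$. Let $$w_4=\begin{pmatrix}1&0&0&0\\0&0&0&1\\0&1&0&0\\0&0&1&0\end{pmatrix},\ w_5=\begin{pmatrix}0&1&0&0\\0&0&0&1\\1&0&0&0\\0&0&1&0\end{pmatrix},\ w_6=\begin{pmatrix}0&0&1&0\\0&0&0&1\\1&0&0&0\\0&1&0&0\end{pmatrix},\ \xi_p^{(0)}=\begin{pmatrix}1&0&0&0\\0&1&0&0\\0&0&1&0\\0&1&0&1\end{pmatrix}.$$ Then (i) $P(\mathbb{Q}_p)w_4K=P(\mathbb{Q}_p)w_5K=P(\mathbb{Q}_p)w_6K=P(\mathbb{Q}_p)\xi_p^{(0)}K$; and (ii) $\kappa_P\bigl(P(\mathbb{Q}_p)\cap \xi_p^{(0)}K(\xi_p^{(0)})^{ -1}\bigr)=K_p(n+n')\times\mathrm{GL}_2(\mathbb{Z}_p)$.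
   Context: $K_p^{m}=\{g\in\mathrm{GL}_4(\mathbb{Z}_p):\text{last row of }g\equiv(0,0,0,1)\bmod p^m\}$. For $m\ge0$, $K_p(m)=\{g\in\mathrm{GL}_2(\mathbb{Z}_p): g\equiv\begin{pmatrix}*&*\\0&1\end{pmatrix}\bmod p^m\}$ (so $K_p(0)=\mathrm{GL}_2(\mathbb{Z}_p)$). $\kappa_P:P\to M_P\cong\mathrm{GL}_2\times\mathrm{GL}_2$ is the projection $\begin{pmatrix}A&B\\0&D\end{pmatrix}\mapsto(A,D)$ onto the Levi quotient. -}

module Defs where

open import Data.Nat using (ℕ; zero; suc; _+_; _*_; _^_; _%_; NonZero)
open import Data.Nat.Properties using (m^n≢0)
open import Data.Nat.DivMod using (%-distribˡ-+; %-distribˡ-*)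
open import Data.Fin using (Fin; zero; suc; _↑ˡ_; _↑ʳ_)
open import Data.Vec using (Vec; lookup; _∷_; [])
open import Data.Product using (Σ; ∃; _×_; _,_)
open import Relation.Binary.PropositionalEquality using (_≡_; refl; cong₂; trans; sym)

module Padic (p : ℕ) .{{nzp : NonZero p}} where

  _%p^_ : ℕ → ℕ → ℕ
  x %p^ k = _%_ x (p ^ k) {{m^n≢0 p k}}
  infixl 7 _%p^_

  -- ℤ_p as the inverse limit of ℤ/p^k: a sequence of naturals x k
  -- (read modulo p^k) which is compatible: x (k+1) ≡ x k (mod p^k).
  record ℤp : Set where
    constructor mkℤp
    field
      seq : ℕ → ℕ
      coh : ∀ k → seq (suc k) %p^ k ≡ seq k %p^ k
  open ℤp public

  _≈z_ : ℤp → ℤp → Set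
  x ≈z y = ∀ k → seq x k %p^ k ≡ seq y k %p^ k

  fromℕ : ℕ → ℤp
  fromℕ n = mkℤp (λ _ → n) (λ _ → refl)

  _+z_ : ℤp → ℤp → ℤp
  x +z y = mkℤp (λ k → seq x k + seq y k) pf
    where
    pf : ∀ k → (seq x (suc k) + seq y (suc k)) %p^ k ≡ (seq x k + seq y k) %p^ k
    pf k = trans (%-distribˡ-+ (seq x (suc k)) (seq y (suc k)) (p ^ k) {{m^n≢0 p k}})
             (trans (cong₂ (λ a b → (a + b) %p^ k) (coh x k) (coh y k))
               (sym (%-distribˡ-+ (seq x k) (seq y k) (p ^ k) {{m^n≢0 p k}})))

  _*z_ : ℤp → ℤp → ℤp
  x *z y = mkℤp (λ k → seq x k * seq y k) pf
    where
    pf : ∀ k → (seq x (suc k) * seq y (suc k)) %p^ k ≡ (seq x k * seq y k) %p^ k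
    pf k = trans (%-distribˡ-* (seq x (suc k)) (seq y (suc k)) (p ^ k) {{m^n≢0 p k}})
             (trans (cong₂ (λ a b → (a * b) %p^ k) (coh x k) (coh y k))
               (sym (%-distribˡ-* (seq x k) (seq y k) (p ^ k) {{m^n≢0 p k}})))

  -- ℚ_p = ℤ_p[1/p]: a pair (a , e) denotes a / p^e.
  ℚp : Set
  ℚp = ℤp × ℕ

  _≈_ : ℚp → ℚp → Set
  (a , e) ≈ (b , f) = (fromℕ (p ^ f) *z a) ≈z (fromℕ (p ^ e) *z b)

  _+q_ : ℚp → ℚp → ℚp
  (a , e) +q (b , f) = ((fromℕ (p ^ f) *z a) +z (fromℕ (p ^ e) *z b)) , (e + f)

  _*q_ : ℚp → ℚp → ℚp
  (a , e) *q (b , f) = (a *z b) , (e + f)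

  ι : ℤp → ℚp
  ι a = a , 0

  ℕq : ℕ → ℚp
  ℕq n = ι (fromℕ n)

  Cong : ℕ → ℚp → ℕ → Set
  Cong m x c = ∃ λ (a : ℤp) → x ≈ ι (fromℕ c +z (fromℕ (p ^ m) *z a))

  Integral : ℚp → Set
  Integral x = Cong 0 x 0

  Mat : ℕ → Set
  Mat n = Fin n → Fin n → ℚp

  sumq : ∀ {n} → (Fin n → ℚp) → ℚp
  sumq {zero} f = ℕq 0
  sumq {suc n} f = f zero +q sumq (λ i → f (suc i))

  _·_ : ∀ {n} → Mat n → Mat n → Mat n
  (g · h) i j = sumq (λ l → g i l *q h l j)

  _≈M_ : ∀ {n} → Mat n → Mat n → Set
  g ≈M h = ∀ i j → g i j ≈ h i j

  δ : ∀ {n} → Fin n → Fin n → ℕ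
  δ zero zero = 1
  δ zero (suc j) = 0
  δ (suc i) zero = 0
  δ (suc i) (suc j) = δ i j

  I : ∀ {n} → Mat n
  I i j = ℕq (δ i j)

  fromTable : ∀ {n} → Vec (Vec ℕ n) n → Mat n
  fromTable t i j = ℕq (lookup (lookup t i) j)

  GL : ∀ {n} → Mat n → Set
  GL {n} g = ∃ λ (h : Mat n) → (g · h) ≈M I × (h · g) ≈M I

  GLℤ : ∀ {n} → Mat n → Set
  GLℤ {n} g = (∀ i j → Integral (g i j)) ×
              (∃ λ (h : Mat n) → (∀ i j → Integral (h i j)) × (g · h) ≈M I × (h · g) ≈M I)

  Mirahoric : ℕ → Mat 4 → Set
  Mirahoric m g = GLℤ g × (∀ j → Cong m (g (suc (suc (suc zero))) j) (δ (suc (suc (suc zero))) j))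

  K2 : ℕ → Mat 2 → Set
  K2 m g = GLℤ g × Cong m (g (suc zero) zero) 0 × Cong m (g (suc zero) (suc zero)) 1

  Parabolic : Mat 4 → Set
  Parabolic g = GL g × (∀ (i j : Fin 2) → g ((2 ↑ʳ i)) ((j ↑ˡ 2)) ≈ ℕq 0)

  κA : Mat 4 → Mat 2
  κA g i j = g ((i ↑ˡ 2)) ((j ↑ˡ 2))

  κD : Mat 4 → Mat 2
  κD g i j = g ((2 ↑ʳ i)) ((2 ↑ʳ j))

  InDoubleCoset : ℕ → Mat 4 → Mat 4 → Set
  InDoubleCoset m w g = ∃ λ (q : Mat 4) → ∃ λ (k : Mat 4) →
    Parabolic q × Mirahoric m k × g ≈M ((q · w) · k)

  -- membership in ξ K ξ⁻¹, i.e. q = ξ k ξ⁻¹ for some k ∈ K  (⇔ q ξ = ξ k)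
  InConj : ℕ → Mat 4 → Mat 4 → Set
  InConj m ξ q = ∃ λ (k : Mat 4) → Mirahoric m k × (q · ξ) ≈M (ξ · k)

  w₄ : Mat 4
  w₄ = fromTable ((1 ∷ 0 ∷ 0 ∷ 0 ∷ []) ∷ (0 ∷ 0 ∷ 0 ∷ 1 ∷ []) ∷ (0 ∷ 1 ∷ 0 ∷ 0 ∷ []) ∷ (0 ∷ 0 ∷ 1 ∷ 0 ∷ []) ∷ [])

  w₅ : Mat 4
  w₅ = fromTable ((0 ∷ 1 ∷ 0 ∷ 0 ∷ []) ∷ (0 ∷ 0 ∷ 0 ∷ 1 ∷ []) ∷ (1 ∷ 0 ∷ 0 ∷ 0 ∷ []) ∷ (0 ∷ 0 ∷ 1 ∷ 0 ∷ []) ∷ [])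

  w₆ : Mat 4
  w₆ = fromTable ((0 ∷ 0 ∷ 1 ∷ 0 ∷ []) ∷ (0 ∷ 0 ∷ 0 ∷ 1 ∷ []) ∷ (1 ∷ 0 ∷ 0 ∷ 0 ∷ []) ∷ (0 ∷ 1 ∷ 0 ∷ 0 ∷ []) ∷ [])

  ξ₀ : Mat 4
  ξ₀ = fromTable ((1 ∷ 0 ∷ 0 ∷ 0 ∷ []) ∷ (0 ∷ 1 ∷ 0 ∷ 0 ∷ []) ∷ (0 ∷ 0 ∷ 1 ∷ 0 ∷ []) ∷ (0 ∷ 1 ∷ 0 ∷ 1 ∷ []) ∷ [])

module Submission where

-- Part (i): each wᵢ factors over ℤ as σ ξ kᵢ, where σ is an involution in the parabolic P and
-- kᵢ lies in the mirahoric K, so wᵢ ∈ P ξ K and ξ = σ wᵢ kᵢ⁻¹ ∈ P wᵢ K; these integer identities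
-- are checked by evaluation and transported to ℚ_p.
-- Part (ii): if q ∈ P and q ξ = ξ k with k ∈ K, then q = ξ k ξ⁻¹ is integral with integral inverse,
-- so its diagonal blocks A and D are in GL₂(ℤ_p) (a one-sided inverse of a 2 × 2 matrix is
-- two-sided). The last row of k = ξ⁻¹ q ξ is (q₃₀ − q₁₀ , q₃₁ − q₁₁ + q₃₃ − q₁₃ , q₃₂ − q₁₂ , q₃₃ − q₁₃),
-- and q₃₀ = q₃₁ = 0, so k ∈ K forces A₁₀ ≡ 0 and A₁₁ ≡ 1 mod p^m. Conversely, for A ∈ K_p(m) and
-- D ∈ GL₂(ℤ_p) the block matrix (A B ; 0 D), with B having second row (D₁₀ , D₁₁ − 1), conjugates into K.

open import Defs
open import Level using (0ℓ)
open import Data.Nat using (ℕ; zero; suc; z≤n; _+_; _*_; _^_; _%_; _∸_; NonZero)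
open import Data.Nat.Properties using (m^n≢0; m*n≢0; ^-distribˡ-+-*; *-cancelˡ-≡; +-comm; +-suc; *-comm)
open import Data.Nat.DivMod using (%-distribˡ-+; %-distribˡ-*; %-congʳ; m∣n⇒o%n%m≡o%m; m%n*o≡m*o%[n*o]; [m+kn]%n≡m%n; n%n≡0)
open import Data.Nat.Divisibility using (divides)
open import Data.Nat.Primality using (Prime)
open import Data.Nat.Tactic.RingSolver using (solve-∀)
open import Data.Fin using (Fin; zero; suc; #_; _↑ˡ_; _↑ʳ_; splitAt; join)
open import Data.Fin.Properties using (all?; join-splitAt; splitAt-↑ˡ; splitAt-↑ʳ)
open import Data.Integer as ℤ using (ℤ; +_; -[1+_]; _⊖_; _◃_)
import Data.Integer.Properties as ℤ
import Data.Sign as Sign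
open import Data.Maybe using (Maybe; just; nothing)
open import Data.Product using (Σ; ∃; _×_; _,_; proj₁; proj₂)
open import Data.Sum using (_⊎_; inj₁; inj₂)
open import Data.Vec using (Vec; lookup; _∷_; [])
open import Function.Bundles using (_⇔_; mk⇔)
open import Relation.Nullary using (Dec; yes; no)
open import Relation.Nullary.Decidable using (from-yes; _×-dec_)
open import Relation.Binary.PropositionalEquality using (_≡_; refl; sym; trans; cong; cong₂; subst)
open import Relation.Binary.Structures using (IsEquivalence)
open import Algebra.Structures.Biased using (isCommutativeSemiringˡ; isCommutativeMonoidˡ)
open import Algebra.Solver.Ring.AlmostCommutativeRing using (AlmostCommutativeRing; _-Raw-AlmostCommutative⟶_)
import Algebra.Solver.Ring
import Relation.Binary.Reasoning.Setoid as SetoidReasoning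

module PadicRing (p : ℕ) .{{p≢0 : NonZero p}} where
  open Padic p

  p^≢0 : ∀ k → NonZero (p ^ k)
  p^≢0 k = m^n≢0 p k

  infix 4 _≡[p^_]_
  _≡[p^_]_ : ℕ → ℕ → ℕ → Set
  a ≡[p^ k ] b = a %p^ k ≡ b %p^ k

  ≡⇒≡[p^] : ∀ {k a b} → a ≡ b → a ≡[p^ k ] b
  ≡⇒≡[p^] refl = refl

  +-cong-≡[p^] : ∀ {k a a′ b b′} → a ≡[p^ k ] a′ → b ≡[p^ k ] b′ → a + b ≡[p^ k ] a′ + b′
  +-cong-≡[p^] {k} {a} {a′} {b} {b′} ha hb =
    trans (%-distribˡ-+ a b (p ^ k) {{p^≢0 k}})
      (trans (cong₂ (λ x y → (x + y) %p^ k) ha hb) (sym (%-distribˡ-+ a′ b′ (p ^ k) {{p^≢0 k}})))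

  *-cong-≡[p^] : ∀ {k a a′ b b′} → a ≡[p^ k ] a′ → b ≡[p^ k ] b′ → a * b ≡[p^ k ] a′ * b′
  *-cong-≡[p^] {k} {a} {a′} {b} {b′} ha hb =
    trans (%-distribˡ-* a b (p ^ k) {{p^≢0 k}})
      (trans (cong₂ (λ x y → (x * y) %p^ k) ha hb) (sym (%-distribˡ-* a′ b′ (p ^ k) {{p^≢0 k}})))

  seq-stable : ∀ (x : ℤp) j k → seq x (k + j) ≡[p^ k ] seq x k
  seq-stable x zero k = cong (λ t → seq x t %p^ k) (+-comm k 0)
  seq-stable x (suc j) k =
    trans (cong (λ t → seq x t %p^ k) (+-suc k j))
      (trans (sym (reduce (seq x (suc (k + j)))))
        (trans (cong (_%p^ k) (coh x (k + j)))
          (trans (reduce (seq x (k + j))) (seq-stable x j k))))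
    where
    reduce : ∀ a → a %p^ (k + j) %p^ k ≡ a %p^ k
    reduce a = m∣n⇒o%n%m≡o%m (p ^ k) (p ^ (k + j)) a {{p^≢0 k}} {{p^≢0 (k + j)}}
      (divides (p ^ j) (trans (^-distribˡ-+-* p k j) (*-comm (p ^ k) (p ^ j))))

  -- Read x at level k + f: there p^f x mod p^(k+f) is p^f (x mod p^k), and p^f cancels.
  p^-*z-cancelˡ : ∀ f {x y} → (fromℕ (p ^ f) *z x) ≈z (fromℕ (p ^ f) *z y) → x ≈z y
  p^-*z-cancelˡ f {x} {y} h k =
    trans (sym (seq-stable x f k)) (trans cancelled (seq-stable y f k))
    where
    p^k*p^f≢0 : NonZero (p ^ k * p ^ f)
    p^k*p^f≢0 = m*n≢0 (p ^ k) (p ^ f) {{p^≢0 k}} {{p^≢0 f}}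
    scaled : ∀ a → (p ^ f * a) %p^ (k + f) ≡ p ^ f * (a %p^ k)
    scaled a = trans (%-congʳ {{p^≢0 (k + f)}} {{p^k*p^f≢0}} (^-distribˡ-+-* p k f))
      (trans (cong (λ t → _%_ t (p ^ k * p ^ f) {{p^k*p^f≢0}}) (*-comm (p ^ f) a))
        (trans (sym (m%n*o≡m*o%[n*o] a (p ^ k) (p ^ f) {{p^≢0 k}} {{p^k*p^f≢0}}))
          (*-comm (a %p^ k) (p ^ f))))
    cancelled : seq x (k + f) ≡[p^ k ] seq y (k + f)
    cancelled = *-cancelˡ-≡ _ _ (p ^ f) {{p^≢0 f}}
      (trans (sym (scaled (seq x (k + f)))) (trans (h (k + f)) (scaled (seq y (k + f)))))

  p^-+ : ∀ e f → p ^ (e + f) ≡ p ^ e * p ^ f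
  p^-+ e f = ^-distribˡ-+-* p e f

  -1ℤp : ℤp
  -1ℤp = mkℤp (λ k → p ^ k ∸ 1) (λ k → coherent p (p ^ k) {{p≢0}} {{p^≢0 k}})
    where
    coherent : ∀ a N .{{_ : NonZero a}} .{{_ : NonZero N}} → (a * N ∸ 1) % N ≡ (N ∸ 1) % N
    coherent (suc a) (suc N) = [m+kn]%n≡m%n N a (suc N)

  -q_ : ℚp → ℚp
  -q (a , e) = (-1ℤp *z a) , e

  0q 1q : ℚp
  0q = ℕq 0
  1q = ℕq 1

  private
    swap-* : ∀ A B x → A * (B * x) ≡ B * (A * x)
    swap-* = solve-∀

    ≈-refl : ∀ {x} → x ≈ x
    ≈-refl k = refl

    ≈-sym : ∀ {x y} → x ≈ y → y ≈ x
    ≈-sym h k = sym (h k)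

    ≈-trans : ∀ {x y z} → x ≈ y → y ≈ z → x ≈ z
    ≈-trans {a , e} {b , f} {c , g} h₁ h₂ = p^-*z-cancelˡ f {fromℕ (p ^ g) *z a} {fromℕ (p ^ e) *z c} (λ k →
      trans (≡⇒≡[p^] {k} (swap-* (p ^ f) (p ^ g) (seq a k)))
        (trans (*-cong-≡[p^] {k} {p ^ g} refl (h₁ k))
          (trans (≡⇒≡[p^] {k} (swap-* (p ^ g) (p ^ e) (seq b k)))
            (trans (*-cong-≡[p^] {k} {p ^ e} refl (h₂ k))
              (≡⇒≡[p^] {k} (swap-* (p ^ e) (p ^ f) (seq c k)))))))

    +q-assoc : ∀ x y z → ((x +q y) +q z) ≈ (x +q (y +q z))
    +q-assoc (a , e) (b , f) (c , g) k = ≡⇒≡[p^] {k} eq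
      where
      identity : ∀ E F G A B C → E * (F * G) * (G * (F * A + E * B) + E * F * C)
                                 ≡ E * F * G * (F * G * A + E * (G * B + F * C))
      identity = solve-∀
      eq : p ^ (e + (f + g)) * (p ^ g * (p ^ f * seq a k + p ^ e * seq b k) + p ^ (e + f) * seq c k)
         ≡ p ^ (e + f + g) * (p ^ (f + g) * seq a k + p ^ e * (p ^ g * seq b k + p ^ f * seq c k))
      eq rewrite p^-+ e (f + g) | p^-+ f g | p^-+ (e + f) g | p^-+ e f =
        identity (p ^ e) (p ^ f) (p ^ g) (seq a k) (seq b k) (seq c k)

    +q-comm : ∀ x y → (x +q y) ≈ (y +q x)
    +q-comm (a , e) (b , f) k = ≡⇒≡[p^] {k} eq
      where
      identity : ∀ E F A B → F * E * (F * A + E * B) ≡ E * F * (E * B + F * A)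
      identity = solve-∀
      eq : p ^ (f + e) * (p ^ f * seq a k + p ^ e * seq b k) ≡ p ^ (e + f) * (p ^ e * seq b k + p ^ f * seq a k)
      eq rewrite p^-+ e f | p^-+ f e = identity (p ^ e) (p ^ f) (seq a k) (seq b k)

    +q-identityˡ : ∀ x → (0q +q x) ≈ x
    +q-identityˡ (a , e) k = ≡⇒≡[p^] {k} (identity (p ^ e) (seq a k))
      where
      identity : ∀ E A → E * (E * 0 + 1 * A) ≡ E * A
      identity = solve-∀

    *q-assoc : ∀ x y z → ((x *q y) *q z) ≈ (x *q (y *q z))
    *q-assoc (a , e) (b , f) (c , g) k = ≡⇒≡[p^] {k} eq
      where
      identity : ∀ E F G A B C → E * (F * G) * (A * B * C) ≡ E * F * G * (A * (B * C))
      identity = solve-∀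
      eq : p ^ (e + (f + g)) * (seq a k * seq b k * seq c k) ≡ p ^ (e + f + g) * (seq a k * (seq b k * seq c k))
      eq rewrite p^-+ e (f + g) | p^-+ f g | p^-+ (e + f) g | p^-+ e f =
        identity (p ^ e) (p ^ f) (p ^ g) (seq a k) (seq b k) (seq c k)

    *q-comm : ∀ x y → (x *q y) ≈ (y *q x)
    *q-comm (a , e) (b , f) k = ≡⇒≡[p^] {k} eq
      where
      identity : ∀ E F A B → F * E * (A * B) ≡ E * F * (B * A)
      identity = solve-∀
      eq : p ^ (f + e) * (seq a k * seq b k) ≡ p ^ (e + f) * (seq b k * seq a k)
      eq rewrite p^-+ e f | p^-+ f e = identity (p ^ e) (p ^ f) (seq a k) (seq b k)

    *q-identityˡ : ∀ x → (1q *q x) ≈ x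
    *q-identityˡ (a , e) k = ≡⇒≡[p^] {k} (identity (p ^ e) (seq a k))
      where
      identity : ∀ E A → E * (1 * A) ≡ E * A
      identity = solve-∀

    *q-distribʳ-+q : ∀ x y z → ((y +q z) *q x) ≈ ((y *q x) +q (z *q x))
    *q-distribʳ-+q (a , e) (b , f) (c , g) k = ≡⇒≡[p^] {k} eq
      where
      identity : ∀ E F G A B C → F * E * (G * E) * ((G * B + F * C) * A)
                                 ≡ F * G * E * (G * E * (B * A) + F * E * (C * A))
      identity = solve-∀
      eq : p ^ (f + e + (g + e)) * ((p ^ g * seq b k + p ^ f * seq c k) * seq a k)
         ≡ p ^ (f + g + e) * (p ^ (g + e) * (seq b k * seq a k) + p ^ (f + e) * (seq c k * seq a k))
      eq rewrite p^-+ (f + e) (g + e) | p^-+ f e | p^-+ g e | p^-+ (f + g) e | p^-+ f g =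
        identity (p ^ e) (p ^ f) (p ^ g) (seq a k) (seq b k) (seq c k)

    *q-zeroˡ : ∀ x → (0q *q x) ≈ 0q
    *q-zeroˡ (a , e) k = ≡⇒≡[p^] {k} (identity (p ^ e) (seq a k))
      where
      identity : ∀ E A → 1 * (0 * A) ≡ E * 0
      identity = solve-∀

    -q-distribˡ-*q : ∀ x y → ((-q x) *q y) ≈ (-q (x *q y))
    -q-distribˡ-*q (a , e) (b , f) k = ≡⇒≡[p^] {k} (identity (p ^ (e + f)) (p ^ k ∸ 1) (seq a k) (seq b k))
      where
      identity : ∀ E M A B → E * (M * A * B) ≡ E * (M * (A * B))
      identity = solve-∀

    -q-distrib-+q : ∀ x y → ((-q x) +q (-q y)) ≈ (-q (x +q y))
    -q-distrib-+q (a , e) (b , f) k =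
      ≡⇒≡[p^] {k} (identity (p ^ (e + f)) (p ^ e) (p ^ f) (p ^ k ∸ 1) (seq a k) (seq b k))
      where
      identity : ∀ S E F M A B → S * (F * (M * A) + E * (M * B)) ≡ S * (M * (F * A + E * B))
      identity = solve-∀

    +q-congʳ : ∀ {x x′} y → x ≈ x′ → (x +q y) ≈ (x′ +q y)
    +q-congʳ {a , e} {a′ , e′} (b , f) h k =
      trans (≡⇒≡[p^] {k} expandˡ)
        (trans (+-cong-≡[p^] {k} (*-cong-≡[p^] {k} {p ^ f * p ^ f} refl (h k)) refl) (≡⇒≡[p^] {k} (sym expandʳ)))
      where
      identityˡ : ∀ E E′ F A B → E′ * F * (F * A + E * B) ≡ F * F * (E′ * A) + E * E′ * F * B
      identityˡ = solve-∀
      identityʳ : ∀ E E′ F A B → E * F * (F * A + E′ * B) ≡ F * F * (E * A) + E * E′ * F * B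
      identityʳ = solve-∀
      expandˡ : p ^ (e′ + f) * (p ^ f * seq a k + p ^ e * seq b k)
              ≡ p ^ f * p ^ f * (p ^ e′ * seq a k) + p ^ e * p ^ e′ * p ^ f * seq b k
      expandˡ rewrite p^-+ e′ f = identityˡ (p ^ e) (p ^ e′) (p ^ f) (seq a k) (seq b k)
      expandʳ : p ^ (e + f) * (p ^ f * seq a′ k + p ^ e′ * seq b k)
              ≡ p ^ f * p ^ f * (p ^ e * seq a′ k) + p ^ e * p ^ e′ * p ^ f * seq b k
      expandʳ rewrite p^-+ e f = identityʳ (p ^ e) (p ^ e′) (p ^ f) (seq a′ k) (seq b k)

    *q-congʳ : ∀ {x x′} y → x ≈ x′ → (x *q y) ≈ (x′ *q y)
    *q-congʳ {a , e} {a′ , e′} (b , f) h k =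
      trans (≡⇒≡[p^] {k} (expand e′ a)) (trans (*-cong-≡[p^] {k} (h k) refl) (≡⇒≡[p^] {k} (sym (expand e a′))))
      where
      identity : ∀ E F A B → E * F * (A * B) ≡ (E * A) * (F * B)
      identity = solve-∀
      expand : ∀ e a → p ^ (e + f) * (seq a k * seq b k) ≡ (p ^ e * seq a k) * (p ^ f * seq b k)
      expand e a rewrite p^-+ e f = identity (p ^ e) (p ^ f) (seq a k) (seq b k)

    -q-cong : ∀ {x x′} → x ≈ x′ → (-q x) ≈ (-q x′)
    -q-cong {a , e} {a′ , e′} h k =
      trans (≡⇒≡[p^] {k} (swap-* (p ^ e′) (p ^ k ∸ 1) (seq a k)))
        (trans (*-cong-≡[p^] {k} {p ^ k ∸ 1} refl (h k)) (≡⇒≡[p^] {k} (swap-* (p ^ k ∸ 1) (p ^ e) (seq a′ k))))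

  -- The record and the opaque operations keep the ring solver from unfolding
  -- the representation of ℚp, which it cannot reason about.
  infix 4 _≃_
  record _≃_ (x y : ℚp) : Set where
    constructor ⟨_⟩
    field ≃⇒≈ : x ≈ y
  open _≃_ public

  infixl 6 _⊕_
  infixl 7 _⊗_
  infix 8 ⊝_
  opaque
    _⊕_ : ℚp → ℚp → ℚp
    x ⊕ y = x +q y

    _⊗_ : ℚp → ℚp → ℚp
    x ⊗ y = x *q y

    ⊝_ : ℚp → ℚp
    ⊝ x = -q x

  opaque
    unfolding _⊕_ _⊗_ ⊝_

    ≃-refl : ∀ {x} → x ≃ x
    ≃-refl {x} = ⟨ ≈-refl {x} ⟩

    ≃-sym : ∀ {x y} → x ≃ y → y ≃ x
    ≃-sym {x} {y} h = ⟨ ≈-sym {x} {y} (≃⇒≈ h) ⟩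

    ≃-trans : ∀ {x y z} → x ≃ y → y ≃ z → x ≃ z
    ≃-trans {x} {y} {z} h₁ h₂ = ⟨ ≈-trans {x} {y} {z} (≃⇒≈ h₁) (≃⇒≈ h₂) ⟩

    ⊕-assoc : ∀ x y z → (x ⊕ y) ⊕ z ≃ x ⊕ (y ⊕ z)
    ⊕-assoc x y z = ⟨ +q-assoc x y z ⟩

    ⊕-comm : ∀ x y → x ⊕ y ≃ y ⊕ x
    ⊕-comm x y = ⟨ +q-comm x y ⟩

    ⊕-identityˡ : ∀ x → 0q ⊕ x ≃ x
    ⊕-identityˡ x = ⟨ +q-identityˡ x ⟩

    ⊗-assoc : ∀ x y z → (x ⊗ y) ⊗ z ≃ x ⊗ (y ⊗ z)
    ⊗-assoc x y z = ⟨ *q-assoc x y z ⟩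

    ⊗-comm : ∀ x y → x ⊗ y ≃ y ⊗ x
    ⊗-comm x y = ⟨ *q-comm x y ⟩

    ⊗-identityˡ : ∀ x → 1q ⊗ x ≃ x
    ⊗-identityˡ x = ⟨ *q-identityˡ x ⟩

    ⊗-distribʳ-⊕ : ∀ x y z → (y ⊕ z) ⊗ x ≃ (y ⊗ x) ⊕ (z ⊗ x)
    ⊗-distribʳ-⊕ x y z = ⟨ *q-distribʳ-+q x y z ⟩

    ⊗-zeroˡ : ∀ x → 0q ⊗ x ≃ 0q
    ⊗-zeroˡ x = ⟨ *q-zeroˡ x ⟩

    ⊝-distribˡ-⊗ : ∀ x y → ⊝ x ⊗ y ≃ ⊝ (x ⊗ y)
    ⊝-distribˡ-⊗ x y = ⟨ -q-distribˡ-*q x y ⟩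

    ⊝-distrib-⊕ : ∀ x y → ⊝ x ⊕ ⊝ y ≃ ⊝ (x ⊕ y)
    ⊝-distrib-⊕ x y = ⟨ -q-distrib-+q x y ⟩

    ⊕-congʳ : ∀ {x x′} y → x ≃ x′ → x ⊕ y ≃ x′ ⊕ y
    ⊕-congʳ {x} {x′} y h = ⟨ +q-congʳ {x} {x′} y (≃⇒≈ h) ⟩

    ⊗-congʳ : ∀ {x x′} y → x ≃ x′ → x ⊗ y ≃ x′ ⊗ y
    ⊗-congʳ {x} {x′} y h = ⟨ *q-congʳ {x} {x′} y (≃⇒≈ h) ⟩

    ⊝-cong : ∀ {x x′} → x ≃ x′ → ⊝ x ≃ ⊝ x′
    ⊝-cong {x} {x′} h = ⟨ -q-cong {x} {x′} (≃⇒≈ h) ⟩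

    1⊕⊝1≃0 : 1q ⊕ ⊝ 1q ≃ 0q
    1⊕⊝1≃0 = ⟨ (λ k → p^k-1+1 (p ^ k) {{p^≢0 k}}) ⟩
      where
      p^k-1+1 : ∀ N .{{_ : NonZero N}} → (1 * (1 * 1 + 1 * ((N ∸ 1) * 1))) % N ≡ (1 * 0) % N
      p^k-1+1 (suc N) = trans (cong (_% suc N) (identity N)) (n%n≡0 (suc N))
        where
        identity : ∀ N → 1 * (1 * 1 + 1 * (N * 1)) ≡ suc N
        identity = solve-∀

    ℕq-homo-+ : ∀ m n → ℕq (m + n) ≃ ℕq m ⊕ ℕq n
    ℕq-homo-+ m n = ⟨ (λ k → cong (_%p^ k) (identity m n)) ⟩
      where
      identity : ∀ m n → 1 * (m + n) ≡ 1 * (1 * m + 1 * n)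
      identity = solve-∀

    ℕq-homo-* : ∀ m n → ℕq (m * n) ≃ ℕq m ⊗ ℕq n
    ℕq-homo-* m n = ⟨ (λ k → refl) ⟩

    ⊝0≃0 : ⊝ 0q ≃ 0q
    ⊝0≃0 = ⟨ (λ k → cong (_%p^ k) (identity (p ^ k ∸ 1))) ⟩
      where
      identity : ∀ N → 1 * (N * 0) ≡ 1 * 0
      identity = solve-∀

  ⊕-cong : ∀ {x y u v} → x ≃ y → u ≃ v → x ⊕ u ≃ y ⊕ v
  ⊕-cong {x} {y} {u} {v} h₁ h₂ =
    ≃-trans (⊕-congʳ u h₁) (≃-trans (⊕-comm y u) (≃-trans (⊕-congʳ y h₂) (⊕-comm v y)))

  ⊗-cong : ∀ {x y u v} → x ≃ y → u ≃ v → x ⊗ u ≃ y ⊗ v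
  ⊗-cong {x} {y} {u} {v} h₁ h₂ =
    ≃-trans (⊗-congʳ u h₁) (≃-trans (⊗-comm y u) (≃-trans (⊗-congʳ y h₂) (⊗-comm v y)))

  ℚpRing : AlmostCommutativeRing 0ℓ 0ℓ
  ℚpRing = record
    { Carrier = ℚp ; _≈_ = _≃_ ; _+_ = _⊕_ ; _*_ = _⊗_ ; -_ = ⊝_ ; 0# = 0q ; 1# = 1q
    ; isAlmostCommutativeRing = record
      { isCommutativeSemiring = isCommutativeSemiringˡ (record
        { +-isCommutativeMonoid = isCommutativeMonoidˡ (record
            { isSemigroup = record { isMagma = record { isEquivalence = ≃-isEquivalence ; ∙-cong = ⊕-cong }
                                   ; assoc = ⊕-assoc }
            ; identityˡ = ⊕-identityˡ ; comm = ⊕-comm })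
        ; *-isCommutativeMonoid = isCommutativeMonoidˡ (record
            { isSemigroup = record { isMagma = record { isEquivalence = ≃-isEquivalence ; ∙-cong = ⊗-cong }
                                   ; assoc = ⊗-assoc }
            ; identityˡ = ⊗-identityˡ ; comm = ⊗-comm })
        ; distribʳ = ⊗-distribʳ-⊕
        ; zeroˡ = ⊗-zeroˡ })
      ; -‿cong = ⊝-cong
      ; -‿*-distribˡ = ⊝-distribˡ-⊗
      ; -‿+-comm = ⊝-distrib-⊕ } }
    where
    ≃-isEquivalence : IsEquivalence _≃_
    ≃-isEquivalence = record { refl = ≃-refl ; sym = ≃-sym ; trans = ≃-trans }

  open AlmostCommutativeRing ℚpRing public using (setoid; +-identityʳ; distribˡ; zeroʳ)
  open SetoidReasoning setoid

  ⊕-inverseʳ : ∀ x → x ⊕ ⊝ x ≃ 0q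
  ⊕-inverseʳ x = begin
    x ⊕ ⊝ x                ≈⟨ ⊕-cong (≃-sym (⊗-identityˡ x)) (⊝-cong (≃-sym (⊗-identityˡ x))) ⟩
    (1q ⊗ x) ⊕ ⊝ (1q ⊗ x)  ≈⟨ ⊕-cong ≃-refl (≃-sym (⊝-distribˡ-⊗ 1q x)) ⟩
    (1q ⊗ x) ⊕ (⊝ 1q ⊗ x)  ≈⟨ ≃-sym (⊗-distribʳ-⊕ x 1q (⊝ 1q)) ⟩
    (1q ⊕ ⊝ 1q) ⊗ x        ≈⟨ ⊗-cong 1⊕⊝1≃0 ≃-refl ⟩
    0q ⊗ x                 ≈⟨ ⊗-zeroˡ x ⟩
    0q                     ∎

  ⊝-involutive : ∀ x → ⊝ (⊝ x) ≃ x
  ⊝-involutive x = begin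
    ⊝ (⊝ x)                  ≈⟨ ≃-sym (+-identityʳ (⊝ (⊝ x))) ⟩
    ⊝ (⊝ x) ⊕ 0q             ≈⟨ ⊕-cong ≃-refl (≃-sym (⊕-inverseʳ x)) ⟩
    ⊝ (⊝ x) ⊕ (x ⊕ ⊝ x)      ≈⟨ ⊕-cong ≃-refl (⊕-comm x (⊝ x)) ⟩
    ⊝ (⊝ x) ⊕ (⊝ x ⊕ x)      ≈⟨ ≃-sym (⊕-assoc _ _ _) ⟩
    (⊝ (⊝ x) ⊕ ⊝ x) ⊕ x      ≈⟨ ⊕-cong (⊕-comm _ _) ≃-refl ⟩
    (⊝ x ⊕ ⊝ (⊝ x)) ⊕ x      ≈⟨ ⊕-cong (⊕-inverseʳ (⊝ x)) ≃-refl ⟩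
    0q ⊕ x                   ≈⟨ ⊕-identityˡ x ⟩
    x                        ∎

  ⊝-distribʳ-⊗ : ∀ a b → ⊝ (a ⊗ b) ≃ a ⊗ ⊝ b
  ⊝-distribʳ-⊗ a b = begin
    ⊝ (a ⊗ b)  ≈⟨ ⊝-cong (⊗-comm a b) ⟩
    ⊝ (b ⊗ a)  ≈⟨ ≃-sym (⊝-distribˡ-⊗ b a) ⟩
    ⊝ b ⊗ a    ≈⟨ ⊗-comm (⊝ b) a ⟩
    a ⊗ ⊝ b    ∎

  ⟦_⟧ℤ : ℤ → ℚp
  ⟦ + n ⟧ℤ = ℕq n
  ⟦ -[1+ n ] ⟧ℤ = ⊝ ℕq (suc n)

  private
    ⟦-+⟧ℤ : ∀ n → ⟦ ℤ.- (+ n) ⟧ℤ ≃ ⊝ ℕq n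
    ⟦-+⟧ℤ zero = ≃-sym ⊝0≃0
    ⟦-+⟧ℤ (suc n) = ≃-refl

    ⟦⊖⟧ℤ : ∀ m n → ⟦ m ⊖ n ⟧ℤ ≃ ℕq m ⊕ ⊝ ℕq n
    ⟦⊖⟧ℤ m zero = begin
      ⟦ m ⊖ 0 ⟧ℤ      ≡⟨ cong ⟦_⟧ℤ (ℤ.⊖-≥ z≤n) ⟩
      ℕq m            ≈⟨ ≃-sym (+-identityʳ _) ⟩
      ℕq m ⊕ 0q       ≈⟨ ⊕-cong ≃-refl (≃-sym ⊝0≃0) ⟩
      ℕq m ⊕ ⊝ ℕq 0   ∎
    ⟦⊖⟧ℤ zero (suc n) = begin
      ⟦ 0 ⊖ suc n ⟧ℤ       ≡⟨ cong ⟦_⟧ℤ (ℤ.⊖-≤ z≤n) ⟩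
      ⊝ ℕq (suc n)         ≈⟨ ≃-sym (⊕-identityˡ _) ⟩
      0q ⊕ ⊝ ℕq (suc n)    ∎
    ⟦⊖⟧ℤ (suc m) (suc n) = begin
      ⟦ suc m ⊖ suc n ⟧ℤ                  ≡⟨ cong ⟦_⟧ℤ (ℤ.[1+m]⊖[1+n]≡m⊖n m n) ⟩
      ⟦ m ⊖ n ⟧ℤ                          ≈⟨ ⟦⊖⟧ℤ m n ⟩
      ℕq m ⊕ ⊝ ℕq n                       ≈⟨ ≃-sym (+-identityʳ _) ⟩
      (ℕq m ⊕ ⊝ ℕq n) ⊕ 0q                ≈⟨ ⊕-cong ≃-refl (≃-sym 1⊕⊝1≃0) ⟩
      (ℕq m ⊕ ⊝ ℕq n) ⊕ (1q ⊕ ⊝ 1q)       ≈⟨ interchange (ℕq m) (⊝ ℕq n) 1q (⊝ 1q) ⟩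
      (1q ⊕ ℕq m) ⊕ (⊝ 1q ⊕ ⊝ ℕq n)       ≈⟨ ⊕-cong (≃-sym (ℕq-homo-+ 1 m)) (⊝-distrib-⊕ 1q (ℕq n)) ⟩
      ℕq (suc m) ⊕ ⊝ (1q ⊕ ℕq n)          ≈⟨ ⊕-cong ≃-refl (⊝-cong (≃-sym (ℕq-homo-+ 1 n))) ⟩
      ℕq (suc m) ⊕ ⊝ ℕq (suc n)           ∎
      where
      interchange : ∀ a b c d → (a ⊕ b) ⊕ (c ⊕ d) ≃ (c ⊕ a) ⊕ (d ⊕ b)
      interchange a b c d = begin
        (a ⊕ b) ⊕ (c ⊕ d)  ≈⟨ ⊕-assoc a b (c ⊕ d) ⟩
        a ⊕ (b ⊕ (c ⊕ d))  ≈⟨ ⊕-cong ≃-refl (≃-sym (⊕-assoc b c d)) ⟩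
        a ⊕ ((b ⊕ c) ⊕ d)  ≈⟨ ⊕-cong ≃-refl (⊕-cong (⊕-comm b c) ≃-refl) ⟩
        a ⊕ ((c ⊕ b) ⊕ d)  ≈⟨ ⊕-cong ≃-refl (⊕-assoc c b d) ⟩
        a ⊕ (c ⊕ (b ⊕ d))  ≈⟨ ≃-sym (⊕-assoc a c (b ⊕ d)) ⟩
        (a ⊕ c) ⊕ (b ⊕ d)  ≈⟨ ⊕-cong (⊕-comm a c) (⊕-comm b d) ⟩
        (c ⊕ a) ⊕ (d ⊕ b)  ∎

  ⟦⟧ℤ-homo-+ : ∀ i j → ⟦ i ℤ.+ j ⟧ℤ ≃ ⟦ i ⟧ℤ ⊕ ⟦ j ⟧ℤ
  ⟦⟧ℤ-homo-+ (+ m) (+ n) = ℕq-homo-+ m n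
  ⟦⟧ℤ-homo-+ (+ m) -[1+ n ] = ⟦⊖⟧ℤ m (suc n)
  ⟦⟧ℤ-homo-+ -[1+ m ] (+ n) = ≃-trans (⟦⊖⟧ℤ n (suc m)) (⊕-comm _ _)
  ⟦⟧ℤ-homo-+ -[1+ m ] -[1+ n ] = begin
    ⊝ ℕq (suc (suc (m + n)))        ≡⟨ cong (λ t → ⊝ ℕq (suc t)) (sym (+-suc m n)) ⟩
    ⊝ ℕq (suc m + suc n)            ≈⟨ ⊝-cong (ℕq-homo-+ (suc m) (suc n)) ⟩
    ⊝ (ℕq (suc m) ⊕ ℕq (suc n))     ≈⟨ ≃-sym (⊝-distrib-⊕ _ _) ⟩
    ⊝ ℕq (suc m) ⊕ ⊝ ℕq (suc n)     ∎

  ⟦⟧ℤ-homo-* : ∀ i j → ⟦ i ℤ.* j ⟧ℤ ≃ ⟦ i ⟧ℤ ⊗ ⟦ j ⟧ℤ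
  ⟦⟧ℤ-homo-* (+ m) (+ n) = begin
    ⟦ Sign.+ ◃ (m * n) ⟧ℤ  ≡⟨ cong ⟦_⟧ℤ (ℤ.+◃n≡+n (m * n)) ⟩
    ℕq (m * n)             ≈⟨ ℕq-homo-* m n ⟩
    ℕq m ⊗ ℕq n            ∎
  ⟦⟧ℤ-homo-* (+ m) -[1+ n ] = begin
    ⟦ Sign.- ◃ (m * suc n) ⟧ℤ  ≡⟨ cong ⟦_⟧ℤ (ℤ.-◃n≡-n (m * suc n)) ⟩
    ⟦ ℤ.- (+ (m * suc n)) ⟧ℤ   ≈⟨ ⟦-+⟧ℤ (m * suc n) ⟩
    ⊝ ℕq (m * suc n)           ≈⟨ ⊝-cong (ℕq-homo-* m (suc n)) ⟩
    ⊝ (ℕq m ⊗ ℕq (suc n))      ≈⟨ ⊝-distribʳ-⊗ _ _ ⟩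
    ℕq m ⊗ ⊝ ℕq (suc n)        ∎
  ⟦⟧ℤ-homo-* -[1+ m ] (+ n) = begin
    ⟦ Sign.- ◃ (suc m * n) ⟧ℤ  ≡⟨ cong ⟦_⟧ℤ (ℤ.-◃n≡-n (suc m * n)) ⟩
    ⟦ ℤ.- (+ (suc m * n)) ⟧ℤ   ≈⟨ ⟦-+⟧ℤ (suc m * n) ⟩
    ⊝ ℕq (suc m * n)           ≈⟨ ⊝-cong (ℕq-homo-* (suc m) n) ⟩
    ⊝ (ℕq (suc m) ⊗ ℕq n)      ≈⟨ ≃-sym (⊝-distribˡ-⊗ _ _) ⟩
    ⊝ ℕq (suc m) ⊗ ℕq n        ∎
  ⟦⟧ℤ-homo-* -[1+ m ] -[1+ n ] = begin
    ⟦ Sign.+ ◃ (suc m * suc n) ⟧ℤ  ≡⟨ cong ⟦_⟧ℤ (ℤ.+◃n≡+n (suc m * suc n)) ⟩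
    ℕq (suc m * suc n)             ≈⟨ ℕq-homo-* (suc m) (suc n) ⟩
    a ⊗ b                          ≈⟨ ≃-sym (⊝-involutive _) ⟩
    ⊝ (⊝ (a ⊗ b))                  ≈⟨ ⊝-cong (⊝-distribʳ-⊗ a b) ⟩
    ⊝ (a ⊗ ⊝ b)                    ≈⟨ ≃-sym (⊝-distribˡ-⊗ a (⊝ b)) ⟩
    ⊝ a ⊗ ⊝ b                      ∎
    where
    a = ℕq (suc m)
    b = ℕq (suc n)

  ⟦⟧ℤ-homo-- : ∀ i → ⟦ ℤ.- i ⟧ℤ ≃ ⊝ ⟦ i ⟧ℤ
  ⟦⟧ℤ-homo-- (+ n) = ⟦-+⟧ℤ n
  ⟦⟧ℤ-homo-- -[1+ n ] = ≃-sym (⊝-involutive _)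

  ⟦⟧ℤ-morphism : ℤ.+-*-rawRing -Raw-AlmostCommutative⟶ ℚpRing
  ⟦⟧ℤ-morphism = record
    { ⟦_⟧ = ⟦_⟧ℤ ; +-homo = ⟦⟧ℤ-homo-+ ; *-homo = ⟦⟧ℤ-homo-* ; -‿homo = ⟦⟧ℤ-homo--
    ; 0-homo = ≃-refl ; 1-homo = ≃-refl }

  ⟦⟧ℤ-equal? : ∀ i j → Maybe (⟦ i ⟧ℤ ≃ ⟦ j ⟧ℤ)
  ⟦⟧ℤ-equal? i j with i ℤ.≟ j
  ... | yes refl = just ≃-refl
  ... | no _ = nothing

  module ℚpSolver = Algebra.Solver.Ring ℤ.+-*-rawRing ℚpRing ⟦⟧ℤ-morphism ⟦⟧ℤ-equal?

module PadicMatrices (p : ℕ) .{{_ : NonZero p}} where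
  open Padic p
  open PadicRing p
  open ℚpSolver using (solve; _:=_; _:+_)
  open SetoidReasoning setoid

  ≡⇒≃ : ∀ {x y} → x ≡ y → x ≃ y
  ≡⇒≃ refl = ≃-refl

  ∑ : ∀ {n} → (Fin n → ℚp) → ℚp
  ∑ {zero} f = 0q
  ∑ {suc n} f = f zero ⊕ ∑ (λ i → f (suc i))

  infixl 7 _⋆_
  _⋆_ : ∀ {n} → Mat n → Mat n → Mat n
  (g ⋆ h) i j = ∑ (λ l → g i l ⊗ h l j)

  infix 4 _≃M_
  _≃M_ : ∀ {n} → Mat n → Mat n → Set
  g ≃M h = ∀ i j → g i j ≃ h i j

  ≃M-refl : ∀ {n} {g : Mat n} → g ≃M g
  ≃M-refl i j = ≃-refl

  ≃M-sym : ∀ {n} {g h : Mat n} → g ≃M h → h ≃M g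
  ≃M-sym e i j = ≃-sym (e i j)

  ≃M-trans : ∀ {n} {g h k : Mat n} → g ≃M h → h ≃M k → g ≃M k
  ≃M-trans e e′ i j = ≃-trans (e i j) (e′ i j)

  ∑-cong : ∀ {n} {f g : Fin n → ℚp} → (∀ i → f i ≃ g i) → ∑ f ≃ ∑ g
  ∑-cong {zero} e = ≃-refl
  ∑-cong {suc n} e = ⊕-cong (e zero) (∑-cong (λ i → e (suc i)))

  ∑-distrib-⊕ : ∀ {n} (f g : Fin n → ℚp) → ∑ (λ i → f i ⊕ g i) ≃ ∑ f ⊕ ∑ g
  ∑-distrib-⊕ {zero} f g = ≃-sym (⊕-identityˡ 0q)
  ∑-distrib-⊕ {suc n} f g =
    ≃-trans (⊕-cong ≃-refl (∑-distrib-⊕ (λ i → f (suc i)) (λ i → g (suc i)))) (interchange _ _ _ _)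
    where
    interchange : ∀ a b c d → (a ⊕ b) ⊕ (c ⊕ d) ≃ (a ⊕ c) ⊕ (b ⊕ d)
    interchange = solve 4 (λ a b c d → (a :+ b) :+ (c :+ d) := (a :+ c) :+ (b :+ d)) ≃-refl

  ⊗-distribˡ-∑ : ∀ {n} c (f : Fin n → ℚp) → c ⊗ ∑ f ≃ ∑ (λ i → c ⊗ f i)
  ⊗-distribˡ-∑ {zero} c f = zeroʳ c
  ⊗-distribˡ-∑ {suc n} c f = ≃-trans (distribˡ c _ _) (⊕-cong ≃-refl (⊗-distribˡ-∑ c (λ i → f (suc i))))

  ⊗-distribʳ-∑ : ∀ {n} c (f : Fin n → ℚp) → ∑ f ⊗ c ≃ ∑ (λ i → f i ⊗ c)
  ⊗-distribʳ-∑ {zero} c f = ⊗-zeroˡ c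
  ⊗-distribʳ-∑ {suc n} c f = ≃-trans (⊗-distribʳ-⊕ c _ _) (⊕-cong ≃-refl (⊗-distribʳ-∑ c (λ i → f (suc i))))

  ∑-zero : ∀ n → ∑ {n} (λ _ → 0q) ≃ 0q
  ∑-zero zero = ≃-refl
  ∑-zero (suc n) = ≃-trans (⊕-identityˡ _) (∑-zero n)

  ∑-comm : ∀ {n m} (h : Fin n → Fin m → ℚp) → ∑ (λ i → ∑ (λ j → h i j)) ≃ ∑ (λ j → ∑ (λ i → h i j))
  ∑-comm {zero} {m} h = ≃-sym (∑-zero m)
  ∑-comm {suc n} {m} h =
    ≃-trans (⊕-cong ≃-refl (∑-comm (λ i j → h (suc i) j)))
      (≃-sym (∑-distrib-⊕ (λ j → h zero j) (λ j → ∑ (λ i → h (suc i) j))))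

  δ-sym : ∀ {n} (i j : Fin n) → δ i j ≡ δ j i
  δ-sym zero zero = refl
  δ-sym zero (suc j) = refl
  δ-sym (suc i) zero = refl
  δ-sym (suc i) (suc j) = δ-sym i j

  ∑-δˡ : ∀ {n} (i : Fin n) (f : Fin n → ℚp) → ∑ (λ l → ℕq (δ i l) ⊗ f l) ≃ f i
  ∑-δˡ {suc n} zero f = ≃-trans
    (⊕-cong (⊗-identityˡ (f zero)) (≃-trans (∑-cong (λ l → ⊗-zeroˡ (f (suc l)))) (∑-zero n)))
    (+-identityʳ _)
  ∑-δˡ {suc n} (suc i) f = ≃-trans (⊕-cong (⊗-zeroˡ (f zero)) (∑-δˡ i (λ l → f (suc l)))) (⊕-identityˡ _)

  ∑-δʳ : ∀ {n} (j : Fin n) (f : Fin n → ℚp) → ∑ (λ l → f l ⊗ ℕq (δ l j)) ≃ f j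
  ∑-δʳ j f = ≃-trans (∑-cong (λ l → ≃-trans (⊗-comm _ _) (≡⇒≃ (cong (λ t → ℕq t ⊗ f l) (δ-sym l j)))))
    (∑-δˡ j f)

  ⋆-cong : ∀ {n} {g g′ h h′ : Mat n} → g ≃M g′ → h ≃M h′ → g ⋆ h ≃M g′ ⋆ h′
  ⋆-cong e e′ i j = ∑-cong (λ l → ⊗-cong (e i l) (e′ l j))

  ⋆-congˡ : ∀ {n} (g : Mat n) {h h′ : Mat n} → h ≃M h′ → g ⋆ h ≃M g ⋆ h′
  ⋆-congˡ g = ⋆-cong (≃M-refl {g = g})

  ⋆-congʳ : ∀ {n} (h : Mat n) {g g′ : Mat n} → g ≃M g′ → g ⋆ h ≃M g′ ⋆ h
  ⋆-congʳ h e = ⋆-cong e (≃M-refl {g = h})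

  ⋆-assoc : ∀ {n} (g h k : Mat n) → (g ⋆ h) ⋆ k ≃M g ⋆ (h ⋆ k)
  ⋆-assoc {n} g h k i j = begin
    ∑ (λ l → ∑ (λ m → g i m ⊗ h m l) ⊗ k l j)    ≈⟨ ∑-cong {n} (λ l → ⊗-distribʳ-∑ (k l j) (λ m → g i m ⊗ h m l)) ⟩
    ∑ (λ l → ∑ (λ m → (g i m ⊗ h m l) ⊗ k l j))  ≈⟨ ∑-comm {n} {n} (λ l m → (g i m ⊗ h m l) ⊗ k l j) ⟩
    ∑ (λ m → ∑ (λ l → (g i m ⊗ h m l) ⊗ k l j))  ≈⟨ ∑-cong {n} (λ m → ∑-cong {n} (λ l → ⊗-assoc _ _ _)) ⟩
    ∑ (λ m → ∑ (λ l → g i m ⊗ (h m l ⊗ k l j)))  ≈⟨ ∑-cong {n} (λ m → ≃-sym (⊗-distribˡ-∑ (g i m) (λ l → h m l ⊗ k l j))) ⟩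
    ∑ (λ m → g i m ⊗ ∑ (λ l → h m l ⊗ k l j))    ∎

  ⋆-identityˡ : ∀ {n} (g : Mat n) → I ⋆ g ≃M g
  ⋆-identityˡ g i j = ∑-δˡ i (λ l → g l j)

  ⋆-identityʳ : ∀ {n} (g : Mat n) → g ⋆ I ≃M g
  ⋆-identityʳ g i j = ∑-δʳ j (λ l → g i l)

  IsIntegral : ℚp → Set
  IsIntegral x = Σ ℤp λ a → x ≃ ι a

  Congruent : ℕ → ℚp → ℕ → Set
  Congruent m x c = Σ ℚp λ y → IsIntegral y × (x ≃ ℕq c ⊕ ℕq (p ^ m) ⊗ y)

  opaque
    unfolding _⊕_ _⊗_ ⊝_

    sumq≃∑ : ∀ {n} (f : Fin n → ℚp) → sumq f ≃ ∑ f
    sumq≃∑ {zero} f = ≃-refl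
    sumq≃∑ {suc n} f = ⊕-cong (≃-refl {f zero}) (sumq≃∑ (λ i → f (suc i)))

    ·≃⋆ : ∀ {n} (g h : Mat n) → g · h ≃M g ⋆ h
    ·≃⋆ g h i j = sumq≃∑ (λ l → g i l *q h l j)

    ι-homo-+ : ∀ a b → ι a ⊕ ι b ≃ ι (a +z b)
    ι-homo-+ a b = ⟨ (λ k → cong (_%p^ k) (identity (seq a k) (seq b k))) ⟩
      where
      identity : ∀ A B → 1 * (1 * A + 1 * B) ≡ 1 * (A + B)
      identity = solve-∀

    ι-homo-* : ∀ a b → ι a ⊗ ι b ≃ ι (a *z b)
    ι-homo-* a b = ⟨ (λ k → refl) ⟩

    ι-homo-⊝ : ∀ a → ⊝ ι a ≃ ι (-1ℤp *z a)
    ι-homo-⊝ a = ⟨ (λ k → refl) ⟩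

    ι-Cong : ∀ m c b → ℕq c ⊕ ℕq (p ^ m) ⊗ ι b ≃ ι (fromℕ c +z (fromℕ (p ^ m) *z b))
    ι-Cong m c b = ⟨ (λ k → cong (_%p^ k) (identity c (p ^ m) (seq b k))) ⟩
      where
      identity : ∀ c N B → 1 * (1 * c + 1 * (N * B)) ≡ 1 * (c + N * B)
      identity = solve-∀

module PadicMatrixGroups (p : ℕ) .{{_ : NonZero p}} where
  open Padic p
  open PadicRing p
  open PadicMatrices p
  open ℚpSolver using (solve; _:=_; _:+_; _:*_; con)

  Integral⇒IsIntegral : ∀ {x} → Integral x → IsIntegral x
  Integral⇒IsIntegral {x} (a , h) = (fromℕ 0 +z (fromℕ 1 *z a)) , ⟨_⟩ {x} h

  IsIntegral⇒Integral : ∀ {x} → IsIntegral x → Integral x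
  IsIntegral⇒Integral (a , h) = a , ≃⇒≈ (≃-trans h (≃-trans unit (ι-Cong 0 0 a)))
    where
    unit : ι a ≃ ℕq 0 ⊕ ℕq 1 ⊗ ι a
    unit = solve 1 (λ y → y := con (+ 0) :+ con (+ 1) :* y) ≃-refl (ι a)

  Cong⇒Congruent : ∀ {m x c} → Cong m x c → Congruent m x c
  Cong⇒Congruent {m} {x} {c} (a , h) = ι a , (a , ≃-refl) , ≃-trans (⟨_⟩ {x} h) (≃-sym (ι-Cong m c a))

  Congruent⇒Cong : ∀ {m x c} → Congruent m x c → Cong m x c
  Congruent⇒Cong {m} {x} {c} (y , (b , y≃b) , h) =
    b , ≃⇒≈ (≃-trans h (≃-trans (⊕-cong ≃-refl (⊗-cong ≃-refl y≃b)) (ι-Cong m c b)))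

  IsIntegral-resp-≃ : ∀ {x y} → x ≃ y → IsIntegral y → IsIntegral x
  IsIntegral-resp-≃ e (a , h) = a , ≃-trans e h

  IsIntegral-⊕ : ∀ {x y} → IsIntegral x → IsIntegral y → IsIntegral (x ⊕ y)
  IsIntegral-⊕ (a , h) (b , h′) = (a +z b) , ≃-trans (⊕-cong h h′) (ι-homo-+ a b)

  IsIntegral-⊗ : ∀ {x y} → IsIntegral x → IsIntegral y → IsIntegral (x ⊗ y)
  IsIntegral-⊗ (a , h) (b , h′) = (a *z b) , ≃-trans (⊗-cong h h′) (ι-homo-* a b)

  IsIntegral-⊝ : ∀ {x} → IsIntegral x → IsIntegral (⊝ x)
  IsIntegral-⊝ (a , h) = (-1ℤp *z a) , ≃-trans (⊝-cong h) (ι-homo-⊝ a)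

  IsIntegral-ℕq : ∀ n → IsIntegral (ℕq n)
  IsIntegral-ℕq n = fromℕ n , ≃-refl

  IsIntegral-∑ : ∀ {n} {f : Fin n → ℚp} → (∀ i → IsIntegral (f i)) → IsIntegral (∑ f)
  IsIntegral-∑ {zero} h = IsIntegral-ℕq 0
  IsIntegral-∑ {suc n} h = IsIntegral-⊕ (h zero) (IsIntegral-∑ (λ i → h (suc i)))

  IntegralMat : ∀ {n} → Mat n → Set
  IntegralMat g = ∀ i j → IsIntegral (g i j)

  IntegralMat-⋆ : ∀ {n} {g h : Mat n} → IntegralMat g → IntegralMat h → IntegralMat (g ⋆ h)
  IntegralMat-⋆ ig ih i j = IsIntegral-∑ (λ l → IsIntegral-⊗ (ig i l) (ih l j))

  Invertible : ∀ {n} → Mat n → Set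
  Invertible {n} g = Σ (Mat n) λ h → g ⋆ h ≃M I × h ⋆ g ≃M I

  IntegrallyInvertible : ∀ {n} → Mat n → Set
  IntegrallyInvertible {n} g = IntegralMat g × Σ (Mat n) λ h → IntegralMat h × g ⋆ h ≃M I × h ⋆ g ≃M I

  IntegrallyInvertible⇒Invertible : ∀ {n} {g : Mat n} → IntegrallyInvertible g → Invertible g
  IntegrallyInvertible⇒Invertible (_ , h , _ , gh , hg) = h , gh , hg

  ·≈I⇒⋆≃I : ∀ {n} {g h : Mat n} → (g · h) ≈M I → g ⋆ h ≃M I
  ·≈I⇒⋆≃I {g = g} {h} e = ≃M-trans (≃M-sym (·≃⋆ g h)) (λ i j → ⟨ e i j ⟩)

  ⋆≃I⇒·≈I : ∀ {n} {g h : Mat n} → g ⋆ h ≃M I → (g · h) ≈M I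
  ⋆≃I⇒·≈I {g = g} {h} e i j = ≃⇒≈ (≃M-trans (·≃⋆ g h) e i j)

  GL⇒Invertible : ∀ {n} {g : Mat n} → GL g → Invertible g
  GL⇒Invertible (h , gh , hg) = h , ·≈I⇒⋆≃I gh , ·≈I⇒⋆≃I hg

  Invertible⇒GL : ∀ {n} {g : Mat n} → Invertible g → GL g
  Invertible⇒GL (h , gh , hg) = h , ⋆≃I⇒·≈I gh , ⋆≃I⇒·≈I hg

  GLℤ⇒IntegrallyInvertible : ∀ {n} {g : Mat n} → GLℤ g → IntegrallyInvertible g
  GLℤ⇒IntegrallyInvertible (ig , h , ih , gh , hg) =
    (λ i j → Integral⇒IsIntegral (ig i j)) , h , (λ i j → Integral⇒IsIntegral (ih i j)) ,
    ·≈I⇒⋆≃I gh , ·≈I⇒⋆≃I hg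

  IntegrallyInvertible⇒GLℤ : ∀ {n} {g : Mat n} → IntegrallyInvertible g → GLℤ g
  IntegrallyInvertible⇒GLℤ (ig , h , ih , gh , hg) =
    (λ i j → IsIntegral⇒Integral (ig i j)) , h , (λ i j → IsIntegral⇒Integral (ih i j)) ,
    ⋆≃I⇒·≈I gh , ⋆≃I⇒·≈I hg

  ⋆-inverse : ∀ {n} {g g′ h h′ : Mat n} → g ⋆ g′ ≃M I → h ⋆ h′ ≃M I → (g ⋆ h) ⋆ (h′ ⋆ g′) ≃M I
  ⋆-inverse {g = g} {g′} {h} {h′} gg′ hh′ =
    ≃M-trans (⋆-assoc g h (h′ ⋆ g′))
      (≃M-trans (⋆-congˡ g (≃M-sym (⋆-assoc h h′ g′)))
        (≃M-trans (⋆-congˡ g (⋆-congʳ g′ hh′)) (≃M-trans (⋆-congˡ g (⋆-identityˡ g′)) gg′)))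

  Invertible-⋆ : ∀ {n} {g h : Mat n} → Invertible g → Invertible h → Invertible (g ⋆ h)
  Invertible-⋆ (g′ , gg′ , g′g) (h′ , hh′ , h′h) = (h′ ⋆ g′) , ⋆-inverse gg′ hh′ , ⋆-inverse h′h g′g

  IntegrallyInvertible-⋆ : ∀ {n} {g h : Mat n} → IntegrallyInvertible g → IntegrallyInvertible h →
                           IntegrallyInvertible (g ⋆ h)
  IntegrallyInvertible-⋆ (ig , g′ , ig′ , gg′ , g′g) (ih , h′ , ih′ , hh′ , h′h) =
    IntegralMat-⋆ ig ih , (h′ ⋆ g′) , IntegralMat-⋆ ih′ ig′ , ⋆-inverse gg′ hh′ , ⋆-inverse h′h g′g

  IntegrallyInvertible-resp-≃M : ∀ {n} {g h : Mat n} → g ≃M h → IntegrallyInvertible g → IntegrallyInvertible h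
  IntegrallyInvertible-resp-≃M e (ig , g′ , ig′ , gg′ , g′g) =
    (λ i j → IsIntegral-resp-≃ (≃-sym (e i j)) (ig i j)) , g′ , ig′ ,
    ≃M-trans (⋆-congʳ g′ (≃M-sym e)) gg′ , ≃M-trans (⋆-congˡ g′ (≃M-sym e)) g′g

↑-elim : ∀ m n {P : Fin (m + n) → Set} → (∀ i → P (i ↑ˡ n)) → (∀ i → P (m ↑ʳ i)) → ∀ i → P i
↑-elim m n {P} left right i = subst P (join-splitAt m n i) (elim (splitAt m i))
  where
  elim : (s : Fin m ⊎ Fin n) → P (join m n s)
  elim (inj₁ i) = left i
  elim (inj₂ i) = right i

blockMat : ∀ {X : Set} {n} → (A B C D : Fin n → Fin n → X) → Fin (n + n) → Fin (n + n) → X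
blockMat {X} {n} A B C D i j = entry (splitAt n i) (splitAt n j)
  where
  entry : Fin n ⊎ Fin n → Fin n ⊎ Fin n → X
  entry (inj₁ i) (inj₁ j) = A i j
  entry (inj₁ i) (inj₂ j) = B i j
  entry (inj₂ i) (inj₁ j) = C i j
  entry (inj₂ i) (inj₂ j) = D i j

module _ {X : Set} {n} (A B C D : Fin n → Fin n → X) (i j : Fin n) where

  blockMat-↑ˡ↑ˡ : blockMat A B C D (i ↑ˡ n) (j ↑ˡ n) ≡ A i j
  blockMat-↑ˡ↑ˡ rewrite splitAt-↑ˡ n i n | splitAt-↑ˡ n j n = refl

  blockMat-↑ˡ↑ʳ : blockMat A B C D (i ↑ˡ n) (n ↑ʳ j) ≡ B i j
  blockMat-↑ˡ↑ʳ rewrite splitAt-↑ˡ n i n | splitAt-↑ʳ n n j = refl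

  blockMat-↑ʳ↑ˡ : blockMat A B C D (n ↑ʳ i) (j ↑ˡ n) ≡ C i j
  blockMat-↑ʳ↑ˡ rewrite splitAt-↑ʳ n n i | splitAt-↑ˡ n j n = refl

  blockMat-↑ʳ↑ʳ : blockMat A B C D (n ↑ʳ i) (n ↑ʳ j) ≡ D i j
  blockMat-↑ʳ↑ʳ rewrite splitAt-↑ʳ n n i | splitAt-↑ʳ n n j = refl

module PadicBlockMatrices (p : ℕ) .{{_ : NonZero p}} where
  open Padic p
  open PadicRing p
  open PadicMatrices p

  module _ {n : ℕ} where

    topLeft topRight bottomLeft bottomRight : Mat (n + n) → Mat n
    topLeft g i j = g (i ↑ˡ n) (j ↑ˡ n)
    topRight g i j = g (i ↑ˡ n) (n ↑ʳ j)
    bottomLeft g i j = g (n ↑ʳ i) (j ↑ˡ n)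
    bottomRight g i j = g (n ↑ʳ i) (n ↑ʳ j)

    ≃M-blockwise : ∀ {g h : Mat (n + n)} →
      topLeft g ≃M topLeft h → topRight g ≃M topRight h →
      bottomLeft g ≃M bottomLeft h → bottomRight g ≃M bottomRight h → g ≃M h
    ≃M-blockwise tl tr bl br =
      ↑-elim n n (λ i → ↑-elim n n (tl i) (tr i)) (λ i → ↑-elim n n (bl i) (br i))

  infixl 6 _⊞_
  _⊞_ : ∀ {n} → Mat n → Mat n → Mat n
  (g ⊞ h) i j = g i j ⊕ h i j

  ⊟ᴹ_ : ∀ {n} → Mat n → Mat n
  (⊟ᴹ g) i j = ⊝ g i j

  𝟘 : ∀ {n} → Mat n
  𝟘 i j = 0q

  ∑-++ : ∀ m {n} (f : Fin (m + n) → ℚp) → ∑ f ≃ ∑ (λ i → f (i ↑ˡ n)) ⊕ ∑ (λ i → f (m ↑ʳ i))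
  ∑-++ zero f = ≃-sym (⊕-identityˡ _)
  ∑-++ (suc m) f = ≃-trans (⊕-cong ≃-refl (∑-++ m (λ i → f (suc i)))) (≃-sym (⊕-assoc _ _ _))

  module _ {n : ℕ} (g h : Mat (n + n)) where

    topLeft-⋆ : topLeft (g ⋆ h) ≃M topLeft g ⋆ topLeft h ⊞ topRight g ⋆ bottomLeft h
    topLeft-⋆ i j = ∑-++ n (λ l → g (i ↑ˡ n) l ⊗ h l (j ↑ˡ n))

    topRight-⋆ : topRight (g ⋆ h) ≃M topLeft g ⋆ topRight h ⊞ topRight g ⋆ bottomRight h
    topRight-⋆ i j = ∑-++ n (λ l → g (i ↑ˡ n) l ⊗ h l (n ↑ʳ j))

    bottomLeft-⋆ : bottomLeft (g ⋆ h) ≃M bottomLeft g ⋆ topLeft h ⊞ bottomRight g ⋆ bottomLeft h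
    bottomLeft-⋆ i j = ∑-++ n (λ l → g (n ↑ʳ i) l ⊗ h l (j ↑ˡ n))

    bottomRight-⋆ : bottomRight (g ⋆ h) ≃M bottomLeft g ⋆ topRight h ⊞ bottomRight g ⋆ bottomRight h
    bottomRight-⋆ i j = ∑-++ n (λ l → g (n ↑ʳ i) l ⊗ h l (n ↑ʳ j))

  module _ {n : ℕ} where

    δ-↑ˡ : ∀ {m} (i j : Fin m) → δ (i ↑ˡ n) (j ↑ˡ n) ≡ δ i j
    δ-↑ˡ zero zero = refl
    δ-↑ˡ zero (suc j) = refl
    δ-↑ˡ (suc i) zero = refl
    δ-↑ˡ (suc i) (suc j) = δ-↑ˡ i j

    δ-↑ʳ : ∀ m (i j : Fin n) → δ (m ↑ʳ i) (m ↑ʳ j) ≡ δ i j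
    δ-↑ʳ zero i j = refl
    δ-↑ʳ (suc m) i j = δ-↑ʳ m i j

    δ-↑ˡ↑ʳ : ∀ {m} (i : Fin m) (j : Fin n) → δ (i ↑ˡ n) (m ↑ʳ j) ≡ 0
    δ-↑ˡ↑ʳ zero j = refl
    δ-↑ˡ↑ʳ (suc i) j = δ-↑ˡ↑ʳ i j

    δ-↑ʳ↑ˡ : ∀ {m} (i : Fin n) (j : Fin m) → δ (m ↑ʳ i) (j ↑ˡ n) ≡ 0
    δ-↑ʳ↑ˡ i zero = refl
    δ-↑ʳ↑ˡ i (suc j) = δ-↑ʳ↑ˡ i j

    topLeft-I : topLeft I ≃M I
    topLeft-I i j = ≡⇒≃ (cong ℕq (δ-↑ˡ i j))

    topRight-I : topRight I ≃M 𝟘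
    topRight-I i j = ≡⇒≃ (cong ℕq (δ-↑ˡ↑ʳ i j))

    bottomLeft-I : bottomLeft I ≃M 𝟘
    bottomLeft-I i j = ≡⇒≃ (cong ℕq (δ-↑ʳ↑ˡ i j))

    bottomRight-I : bottomRight I ≃M I
    bottomRight-I i j = ≡⇒≃ (cong ℕq (δ-↑ʳ n i j))

  module _ {n : ℕ} where

    ⊞-cong : ∀ {g g′ h h′ : Mat n} → g ≃M g′ → h ≃M h′ → g ⊞ h ≃M g′ ⊞ h′
    ⊞-cong e e′ i j = ⊕-cong (e i j) (e′ i j)

    ⊟ᴹ-cong : ∀ {g g′ : Mat n} → g ≃M g′ → ⊟ᴹ g ≃M ⊟ᴹ g′
    ⊟ᴹ-cong e i j = ⊝-cong (e i j)

    ⊞-identityˡ : ∀ (g : Mat n) → 𝟘 ⊞ g ≃M g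
    ⊞-identityˡ g i j = ⊕-identityˡ (g i j)

    ⊞-identityʳ : ∀ (g : Mat n) → g ⊞ 𝟘 ≃M g
    ⊞-identityʳ g i j = +-identityʳ (g i j)

    ⊞-inverseˡ : ∀ (g : Mat n) → ⊟ᴹ g ⊞ g ≃M 𝟘
    ⊞-inverseˡ g i j = ≃-trans (⊕-comm _ _) (⊕-inverseʳ (g i j))

    ⊞-inverseʳ : ∀ (g : Mat n) → g ⊞ ⊟ᴹ g ≃M 𝟘
    ⊞-inverseʳ g i j = ⊕-inverseʳ (g i j)

    ⋆-zeroˡ : ∀ (g : Mat n) → 𝟘 ⋆ g ≃M 𝟘
    ⋆-zeroˡ g i j = ≃-trans (∑-cong (λ l → ⊗-zeroˡ (g l j))) (∑-zero n)

    ⋆-zeroʳ : ∀ (g : Mat n) → g ⋆ 𝟘 ≃M 𝟘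
    ⋆-zeroʳ g i j = ≃-trans (∑-cong (λ l → zeroʳ (g i l))) (∑-zero n)

    ∑-⊝ : ∀ {m} (f : Fin m → ℚp) → ∑ (λ l → ⊝ f l) ≃ ⊝ ∑ f
    ∑-⊝ {zero} f = ≃-sym ⊝0≃0
    ∑-⊝ {suc m} f = ≃-trans (⊕-cong ≃-refl (∑-⊝ (λ l → f (suc l)))) (⊝-distrib-⊕ _ _)

    ⋆-⊟ᴹ : ∀ (g h : Mat n) → g ⋆ ⊟ᴹ h ≃M ⊟ᴹ (g ⋆ h)
    ⋆-⊟ᴹ g h i j = ≃-trans (∑-cong (λ l → ≃-sym (⊝-distribʳ-⊗ (g i l) (h l j)))) (∑-⊝ (λ l → g i l ⊗ h l j))

    ⊟ᴹ-⋆ : ∀ (g h : Mat n) → ⊟ᴹ g ⋆ h ≃M ⊟ᴹ (g ⋆ h)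
    ⊟ᴹ-⋆ g h i j = ≃-trans (∑-cong (λ l → ⊝-distribˡ-⊗ (g i l) (h l j))) (∑-⊝ (λ l → g i l ⊗ h l j))

  BlockUpper : ∀ {n} → Mat (n + n) → Set
  BlockUpper {n} g = bottomLeft {n} g ≃M 𝟘

  module _ {n : ℕ} {g h : Mat (n + n)} where

    BlockUpper-⋆ : BlockUpper {n} g → BlockUpper {n} h → BlockUpper {n} (g ⋆ h)
    BlockUpper-⋆ g₀ h₀ = ≃M-trans (bottomLeft-⋆ g h)
      (≃M-trans (⊞-cong (≃M-trans (⋆-congʳ _ g₀) (⋆-zeroˡ _)) (≃M-trans (⋆-congˡ _ h₀) (⋆-zeroʳ _)))
        (⊞-identityʳ 𝟘))

    topLeft-⋆-BlockUpper : BlockUpper {n} h → topLeft (g ⋆ h) ≃M topLeft g ⋆ topLeft h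
    topLeft-⋆-BlockUpper h₀ = ≃M-trans (topLeft-⋆ g h)
      (≃M-trans (⊞-cong ≃M-refl (≃M-trans (⋆-congˡ _ h₀) (⋆-zeroʳ _))) (⊞-identityʳ _))

    bottomRight-⋆-BlockUpper : BlockUpper {n} g → bottomRight (g ⋆ h) ≃M bottomRight g ⋆ bottomRight h
    bottomRight-⋆-BlockUpper g₀ = ≃M-trans (bottomRight-⋆ g h)
      (≃M-trans (⊞-cong (≃M-trans (⋆-congʳ _ g₀) (⋆-zeroˡ _)) ≃M-refl) (⊞-identityˡ _))

  module _ {n : ℕ} (A B C D : Mat n) where

    topLeft-blockMat : topLeft (blockMat A B C D) ≃M A
    topLeft-blockMat i j = ≡⇒≃ (blockMat-↑ˡ↑ˡ A B C D i j)

    topRight-blockMat : topRight (blockMat A B C D) ≃M B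
    topRight-blockMat i j = ≡⇒≃ (blockMat-↑ˡ↑ʳ A B C D i j)

    bottomLeft-blockMat : bottomLeft (blockMat A B C D) ≃M C
    bottomLeft-blockMat i j = ≡⇒≃ (blockMat-↑ʳ↑ˡ A B C D i j)

    bottomRight-blockMat : bottomRight (blockMat A B C D) ≃M D
    bottomRight-blockMat i j = ≡⇒≃ (blockMat-↑ʳ↑ʳ A B C D i j)

  module BlockUpperInverse {n : ℕ} (A A′ B D D′ : Mat n) where

    N : Mat n
    N = ⊟ᴹ (A′ ⋆ (B ⋆ D′))

    q q⁻¹ : Mat (n + n)
    q = blockMat A B 𝟘 D
    q⁻¹ = blockMat A′ N 𝟘 D′

    q-upper : BlockUpper {n} q
    q-upper = bottomLeft-blockMat A B 𝟘 D

    q⁻¹-upper : BlockUpper {n} q⁻¹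
    q⁻¹-upper = bottomLeft-blockMat A′ N 𝟘 D′

    private
      qTL = topLeft-blockMat A B 𝟘 D
      qTR = topRight-blockMat A B 𝟘 D
      qBR = bottomRight-blockMat A B 𝟘 D
      q⁻¹TL = topLeft-blockMat A′ N 𝟘 D′
      q⁻¹TR = topRight-blockMat A′ N 𝟘 D′
      q⁻¹BR = bottomRight-blockMat A′ N 𝟘 D′

    inverseʳ : A ⋆ A′ ≃M I → D ⋆ D′ ≃M I → q ⋆ q⁻¹ ≃M I
    inverseʳ AA′ DD′ = ≃M-blockwise
      (≃M-trans (topLeft-⋆-BlockUpper {n} {q} {q⁻¹} q⁻¹-upper)
        (≃M-trans (⋆-cong qTL q⁻¹TL) (≃M-trans AA′ (≃M-sym topLeft-I))))
      (≃M-trans (topRight-⋆ q q⁻¹)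
        (≃M-trans (⊞-cong (⋆-cong qTL q⁻¹TR) (⋆-cong qTR q⁻¹BR))
          (≃M-trans (⊞-cong cancel ≃M-refl) (≃M-trans (⊞-inverseˡ (B ⋆ D′)) (≃M-sym topRight-I)))))
      (≃M-trans (BlockUpper-⋆ {n} {q} {q⁻¹} q-upper q⁻¹-upper) (≃M-sym bottomLeft-I))
      (≃M-trans (bottomRight-⋆-BlockUpper {n} {q} {q⁻¹} q-upper)
        (≃M-trans (⋆-cong qBR q⁻¹BR) (≃M-trans DD′ (≃M-sym bottomRight-I))))
      where
      cancel : A ⋆ N ≃M ⊟ᴹ (B ⋆ D′)
      cancel = ≃M-trans (⋆-⊟ᴹ A _) (⊟ᴹ-cong (≃M-trans (≃M-sym (⋆-assoc A A′ (B ⋆ D′)))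
        (≃M-trans (⋆-congʳ (B ⋆ D′) AA′) (⋆-identityˡ (B ⋆ D′)))))

    inverseˡ : A′ ⋆ A ≃M I → D′ ⋆ D ≃M I → q⁻¹ ⋆ q ≃M I
    inverseˡ A′A D′D = ≃M-blockwise
      (≃M-trans (topLeft-⋆-BlockUpper {n} {q⁻¹} {q} q-upper)
        (≃M-trans (⋆-cong q⁻¹TL qTL) (≃M-trans A′A (≃M-sym topLeft-I))))
      (≃M-trans (topRight-⋆ q⁻¹ q)
        (≃M-trans (⊞-cong (⋆-cong q⁻¹TL qTR) (⋆-cong q⁻¹TR qBR))
          (≃M-trans (⊞-cong ≃M-refl cancel) (≃M-trans (⊞-inverseʳ (A′ ⋆ B)) (≃M-sym topRight-I)))))
      (≃M-trans (BlockUpper-⋆ {n} {q⁻¹} {q} q⁻¹-upper q-upper) (≃M-sym bottomLeft-I))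
      (≃M-trans (bottomRight-⋆-BlockUpper {n} {q⁻¹} {q} q⁻¹-upper)
        (≃M-trans (⋆-cong q⁻¹BR qBR) (≃M-trans D′D (≃M-sym bottomRight-I))))
      where
      cancel : N ⋆ D ≃M ⊟ᴹ (A′ ⋆ B)
      cancel = ≃M-trans (⊟ᴹ-⋆ _ D) (⊟ᴹ-cong (≃M-trans (⋆-assoc A′ (B ⋆ D′) D)
        (⋆-congˡ A′ (≃M-trans (⋆-assoc B D′ D) (≃M-trans (⋆-congˡ B D′D) (⋆-identityʳ B))))))

module PadicSubgroups (p : ℕ) .{{_ : NonZero p}} where
  open Padic p
  open PadicRing p
  open PadicMatrices p
  open PadicMatrixGroups p
  open PadicBlockMatrices p
  open ℚpSolver using (solve; _:=_; _:+_; _:*_)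
  open SetoidReasoning setoid

  RowCongruent : ∀ {n} → ℕ → Fin n → Mat n → Set
  RowCongruent m r g = ∀ j → Congruent m (g r j) (δ r j)

  RowCongruent-⋆ : ∀ {n} m r {g h : Mat n} →
    RowCongruent m r g → RowCongruent m r h → IntegralMat h → RowCongruent m r (g ⋆ h)
  RowCongruent-⋆ {n} m r {g} {h} rg rh ih j =
    (y′ ⊕ S) , IsIntegral-⊕ iy′ (IsIntegral-∑ (λ l → IsIntegral-⊗ (proj₁ (proj₂ (rg l))) (ih l j))) , (begin
      ∑ (λ l → g r l ⊗ h l j)                                ≈⟨ ∑-cong (λ l → ⊗-cong (proj₂ (proj₂ (rg l))) ≃-refl) ⟩
      ∑ (λ l → (e l ⊕ P ⊗ y l) ⊗ h l j)                      ≈⟨ ∑-cong (λ l → expand (e l) P (y l) (h l j)) ⟩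
      ∑ (λ l → e l ⊗ h l j ⊕ P ⊗ (y l ⊗ h l j))              ≈⟨ ∑-distrib-⊕ {n} _ _ ⟩
      ∑ (λ l → e l ⊗ h l j) ⊕ ∑ (λ l → P ⊗ (y l ⊗ h l j))    ≈⟨ ⊕-cong (∑-δˡ r (λ l → h l j)) (≃-sym (⊗-distribˡ-∑ {n} P _)) ⟩
      h r j ⊕ P ⊗ S                                          ≈⟨ ⊕-cong ey′ ≃-refl ⟩
      (ℕq (δ r j) ⊕ P ⊗ y′) ⊕ P ⊗ S                          ≈⟨ collect (ℕq (δ r j)) P y′ S ⟩
      ℕq (δ r j) ⊕ P ⊗ (y′ ⊕ S)                              ∎)
    where
    P : ℚp
    P = ℕq (p ^ m)
    e y : Fin n → ℚp
    e l = ℕq (δ r l)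
    y l = proj₁ (rg l)
    S : ℚp
    S = ∑ (λ l → y l ⊗ h l j)
    y′ = proj₁ (rh j)
    iy′ = proj₁ (proj₂ (rh j))
    ey′ = proj₂ (proj₂ (rh j))
    expand : ∀ a P y b → (a ⊕ P ⊗ y) ⊗ b ≃ a ⊗ b ⊕ P ⊗ (y ⊗ b)
    expand = solve 4 (λ a P y b → (a :+ P :* y) :* b := a :* b :+ P :* (y :* b)) ≃-refl
    collect : ∀ d P y S → (d ⊕ P ⊗ y) ⊕ P ⊗ S ≃ d ⊕ P ⊗ (y ⊕ S)
    collect = solve 4 (λ d P y S → (d :+ P :* y) :+ P :* S := d :+ P :* (y :+ S)) ≃-refl

  IsMirahoric : ℕ → Mat 4 → Set
  IsMirahoric m k = IntegrallyInvertible k × RowCongruent m (# 3) k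

  Mirahoric⇒IsMirahoric : ∀ {m k} → Mirahoric m k → IsMirahoric m k
  Mirahoric⇒IsMirahoric {m} {k} (gk , rk) =
    GLℤ⇒IntegrallyInvertible {g = k} gk , (λ j → Cong⇒Congruent {m} {k (# 3) j} (rk j))

  IsMirahoric⇒Mirahoric : ∀ {m k} → IsMirahoric m k → Mirahoric m k
  IsMirahoric⇒Mirahoric {m} {k} (gk , rk) =
    IntegrallyInvertible⇒GLℤ {g = k} gk , (λ j → Congruent⇒Cong {m} {k (# 3) j} (rk j))

  IsMirahoric-⋆ : ∀ {m} {k k′ : Mat 4} → IsMirahoric m k → IsMirahoric m k′ → IsMirahoric m (k ⋆ k′)
  IsMirahoric-⋆ {m} {k} {k′} (gk , rk) (gk′ , rk′) = IntegrallyInvertible-⋆ {g = k} {k′} gk gk′ , RowCongruent-⋆ m (# 3) {k} {k′} rk rk′ (proj₁ gk′)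

  IsParabolic : Mat 4 → Set
  IsParabolic q = Invertible q × BlockUpper {2} q

  Parabolic⇒IsParabolic : ∀ {q} → Parabolic q → IsParabolic q
  Parabolic⇒IsParabolic {q} (gq , zq) = GL⇒Invertible {g = q} gq , (λ i j → ⟨_⟩ {q (2 ↑ʳ i) (j ↑ˡ 2)} (zq i j))

  IsParabolic⇒Parabolic : ∀ {q} → IsParabolic q → Parabolic q
  IsParabolic⇒Parabolic {q} (gq , zq) = Invertible⇒GL {g = q} gq , (λ i j → ≃⇒≈ (zq i j))

  IsParabolic-⋆ : ∀ {q r : Mat 4} → IsParabolic q → IsParabolic r → IsParabolic (q ⋆ r)
  IsParabolic-⋆ {q} {r} (gq , zq) (gr , zr) = Invertible-⋆ {g = q} {r} gq gr , BlockUpper-⋆ {2} {q} {r} zq zr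

  InPwK : ℕ → Mat 4 → Mat 4 → Set
  InPwK m w g = Σ (Mat 4) λ q → Σ (Mat 4) λ k → IsParabolic q × IsMirahoric m k × g ≃M (q ⋆ w) ⋆ k

  InDoubleCoset⇒InPwK : ∀ {m w g} → InDoubleCoset m w g → InPwK m w g
  InDoubleCoset⇒InPwK {m} {w} {g} (q , k , pq , mk , e) =
    q , k , Parabolic⇒IsParabolic {q} pq , Mirahoric⇒IsMirahoric {m} {k} mk ,
    ≃M-trans (λ i j → ⟨_⟩ {g i j} (e i j)) (≃M-trans (·≃⋆ (q · w) k) (⋆-congʳ k (·≃⋆ q w)))

  InPwK⇒InDoubleCoset : ∀ {m w g} → InPwK m w g → InDoubleCoset m w g
  InPwK⇒InDoubleCoset {m} {w} (q , k , pq , mk , e) =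
    q , k , IsParabolic⇒Parabolic {q} pq , IsMirahoric⇒Mirahoric {m} {k} mk ,
    (λ i j → ≃⇒≈ (≃M-trans e (≃M-sym (≃M-trans (·≃⋆ (q · w) k) (⋆-congʳ k (·≃⋆ q w)))) i j))

  InPwK-⊆ : ∀ {m} {w w′ q k : Mat 4} → IsParabolic q → IsMirahoric m k → w ≃M (q ⋆ w′) ⋆ k →
            ∀ {g} → InPwK m w g → InPwK m w′ g
  InPwK-⊆ {m} {w′ = w′} {q = q} {k = k} pq mk e (q₁ , k₁ , pq₁ , mk₁ , e₁) =
    q₁ ⋆ q , k ⋆ k₁ , IsParabolic-⋆ {q₁} {q} pq₁ pq , IsMirahoric-⋆ {m} {k} {k₁} mk mk₁ ,
    ≃M-trans e₁ (≃M-trans (⋆-congʳ k₁ (⋆-congˡ q₁ e)) regroup)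
    where
    regroup : (q₁ ⋆ ((q ⋆ w′) ⋆ k)) ⋆ k₁ ≃M ((q₁ ⋆ q) ⋆ w′) ⋆ (k ⋆ k₁)
    regroup = ≃M-trans (⋆-congʳ k₁ (≃M-sym (⋆-assoc q₁ (q ⋆ w′) k)))
      (≃M-trans (⋆-assoc (q₁ ⋆ (q ⋆ w′)) k k₁) (⋆-congʳ (k ⋆ k₁) (≃M-sym (⋆-assoc q₁ q w′))))

ℤMat : ℕ → Set
ℤMat n = Fin n → Fin n → ℤ

ℤtable : ∀ {n} → Vec (Vec ℤ n) n → ℤMat n
ℤtable t i j = lookup (lookup t i) j

ℕtable : ∀ {n} → Vec (Vec ℕ n) n → ℤMat n
ℕtable t i j = + lookup (lookup t i) j

∑ℤ : ∀ {n} → (Fin n → ℤ) → ℤ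
∑ℤ {zero} f = + 0
∑ℤ {suc n} f = f zero ℤ.+ ∑ℤ (λ i → f (suc i))

infixl 7 _⊛_
_⊛_ : ∀ {n} → ℤMat n → ℤMat n → ℤMat n
(A ⊛ B) i j = ∑ℤ (λ l → A i l ℤ.* B l j)

kronecker : ∀ {n} → Fin n → Fin n → ℕ
kronecker zero zero = 1
kronecker zero (suc j) = 0
kronecker (suc i) zero = 0
kronecker (suc i) (suc j) = kronecker i j

1ℤ : ∀ {n} → ℤMat n
1ℤ i j = + kronecker i j

infix 4 _≡ᴹ_ _≟ᴹ_
_≡ᴹ_ : ∀ {n} → ℤMat n → ℤMat n → Set
A ≡ᴹ B = ∀ i j → A i j ≡ B i j

_≟ᴹ_ : ∀ {n} (A B : ℤMat n) → Dec (A ≡ᴹ B)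
A ≟ᴹ B = all? (λ i → all? (λ j → A i j ℤ.≟ B i j))

LastRowStandard : ℤMat 4 → Set
LastRowStandard A = ∀ j → A (# 3) j ≡ + kronecker (# 3) j

lastRowStandard? : ∀ A → Dec (LastRowStandard A)
lastRowStandard? A = all? (λ j → A (# 3) j ℤ.≟ + kronecker (# 3) j)

ξℤ ξℤ⁻¹ σℤ w₄ℤ w₅ℤ w₆ℤ k₄ℤ k₄ℤ⁻¹ k₅ℤ k₅ℤ⁻¹ k₆ℤ k₆ℤ⁻¹ : ℤMat 4
ξℤ = ℕtable ((1 ∷ 0 ∷ 0 ∷ 0 ∷ []) ∷ (0 ∷ 1 ∷ 0 ∷ 0 ∷ []) ∷ (0 ∷ 0 ∷ 1 ∷ 0 ∷ []) ∷ (0 ∷ 1 ∷ 0 ∷ 1 ∷ []) ∷ [])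
ξℤ⁻¹ = ℤtable ((+ 1 ∷ + 0 ∷ + 0 ∷ + 0 ∷ []) ∷ (+ 0 ∷ + 1 ∷ + 0 ∷ + 0 ∷ []) ∷ (+ 0 ∷ + 0 ∷ + 1 ∷ + 0 ∷ []) ∷ (+ 0 ∷ -[1+ 0 ] ∷ + 0 ∷ + 1 ∷ []) ∷ [])
σℤ = ℤtable ((+ 1 ∷ + 0 ∷ + 0 ∷ + 0 ∷ []) ∷ (+ 0 ∷ -[1+ 0 ] ∷ + 0 ∷ + 1 ∷ []) ∷ (+ 0 ∷ + 0 ∷ + 1 ∷ + 0 ∷ []) ∷ (+ 0 ∷ + 0 ∷ + 0 ∷ + 1 ∷ []) ∷ [])
w₄ℤ = ℕtable ((1 ∷ 0 ∷ 0 ∷ 0 ∷ []) ∷ (0 ∷ 0 ∷ 0 ∷ 1 ∷ []) ∷ (0 ∷ 1 ∷ 0 ∷ 0 ∷ []) ∷ (0 ∷ 0 ∷ 1 ∷ 0 ∷ []) ∷ [])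
w₅ℤ = ℕtable ((0 ∷ 1 ∷ 0 ∷ 0 ∷ []) ∷ (0 ∷ 0 ∷ 0 ∷ 1 ∷ []) ∷ (1 ∷ 0 ∷ 0 ∷ 0 ∷ []) ∷ (0 ∷ 0 ∷ 1 ∷ 0 ∷ []) ∷ [])
w₆ℤ = ℕtable ((0 ∷ 0 ∷ 1 ∷ 0 ∷ []) ∷ (0 ∷ 0 ∷ 0 ∷ 1 ∷ []) ∷ (1 ∷ 0 ∷ 0 ∷ 0 ∷ []) ∷ (0 ∷ 1 ∷ 0 ∷ 0 ∷ []) ∷ [])
k₄ℤ = ℤtable ((+ 1 ∷ + 0 ∷ + 0 ∷ + 0 ∷ []) ∷ (+ 0 ∷ + 0 ∷ + 1 ∷ -[1+ 0 ] ∷ []) ∷ (+ 0 ∷ + 1 ∷ + 0 ∷ + 0 ∷ []) ∷ (+ 0 ∷ + 0 ∷ + 0 ∷ + 1 ∷ []) ∷ [])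
k₄ℤ⁻¹ = ℤtable ((+ 1 ∷ + 0 ∷ + 0 ∷ + 0 ∷ []) ∷ (+ 0 ∷ + 0 ∷ + 1 ∷ + 0 ∷ []) ∷ (+ 0 ∷ + 1 ∷ + 0 ∷ + 1 ∷ []) ∷ (+ 0 ∷ + 0 ∷ + 0 ∷ + 1 ∷ []) ∷ [])
k₅ℤ = ℤtable ((+ 0 ∷ + 1 ∷ + 0 ∷ + 0 ∷ []) ∷ (+ 0 ∷ + 0 ∷ + 1 ∷ -[1+ 0 ] ∷ []) ∷ (+ 1 ∷ + 0 ∷ + 0 ∷ + 0 ∷ []) ∷ (+ 0 ∷ + 0 ∷ + 0 ∷ + 1 ∷ []) ∷ [])
k₅ℤ⁻¹ = ℤtable ((+ 0 ∷ + 0 ∷ + 1 ∷ + 0 ∷ []) ∷ (+ 1 ∷ + 0 ∷ + 0 ∷ + 0 ∷ []) ∷ (+ 0 ∷ + 1 ∷ + 0 ∷ + 1 ∷ []) ∷ (+ 0 ∷ + 0 ∷ + 0 ∷ + 1 ∷ []) ∷ [])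
k₆ℤ = ℤtable ((+ 0 ∷ + 0 ∷ + 1 ∷ + 0 ∷ []) ∷ (+ 0 ∷ + 1 ∷ + 0 ∷ -[1+ 0 ] ∷ []) ∷ (+ 1 ∷ + 0 ∷ + 0 ∷ + 0 ∷ []) ∷ (+ 0 ∷ + 0 ∷ + 0 ∷ + 1 ∷ []) ∷ [])
k₆ℤ⁻¹ = ℤtable ((+ 0 ∷ + 0 ∷ + 1 ∷ + 0 ∷ []) ∷ (+ 0 ∷ + 1 ∷ + 0 ∷ + 1 ∷ []) ∷ (+ 1 ∷ + 0 ∷ + 0 ∷ + 0 ∷ []) ∷ (+ 0 ∷ + 0 ∷ + 0 ∷ + 1 ∷ []) ∷ [])

σσ≡1 : σℤ ⊛ σℤ ≡ᴹ 1ℤ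
σσ≡1 = from-yes (σℤ ⊛ σℤ ≟ᴹ 1ℤ)

ξξ⁻¹≡1 : ξℤ ⊛ ξℤ⁻¹ ≡ᴹ 1ℤ
ξξ⁻¹≡1 = from-yes (ξℤ ⊛ ξℤ⁻¹ ≟ᴹ 1ℤ)

ξ⁻¹ξ≡1 : ξℤ⁻¹ ⊛ ξℤ ≡ᴹ 1ℤ
ξ⁻¹ξ≡1 = from-yes (ξℤ⁻¹ ⊛ ξℤ ≟ᴹ 1ℤ)

σ-blockUpper : ∀ (i j : Fin 2) → σℤ (2 ↑ʳ i) (j ↑ˡ 2) ≡ + 0
σ-blockUpper = from-yes (all? (λ (i : Fin 2) → all? (λ (j : Fin 2) → σℤ (2 ↑ʳ i) (j ↑ˡ 2) ℤ.≟ + 0)))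

-- w lies in P ξ K, witnessed by w = σ ξ k, and conversely ξ = σ w k⁻¹ since σ² = 1.
DoubleCosetCertificate : (w k k⁻¹ : ℤMat 4) → Set
DoubleCosetCertificate w k k⁻¹ =
  (k ⊛ k⁻¹ ≡ᴹ 1ℤ × k⁻¹ ⊛ k ≡ᴹ 1ℤ) × (LastRowStandard k × LastRowStandard k⁻¹) ×
  (w ≡ᴹ (σℤ ⊛ ξℤ) ⊛ k × ξℤ ≡ᴹ (σℤ ⊛ w) ⊛ k⁻¹)

doubleCosetCertificate? : ∀ w k k⁻¹ → Dec (DoubleCosetCertificate w k k⁻¹)
doubleCosetCertificate? w k k⁻¹ =
  ((k ⊛ k⁻¹ ≟ᴹ 1ℤ) ×-dec (k⁻¹ ⊛ k ≟ᴹ 1ℤ)) ×-dec (lastRowStandard? k ×-dec lastRowStandard? k⁻¹) ×-dec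
  ((w ≟ᴹ (σℤ ⊛ ξℤ) ⊛ k) ×-dec (ξℤ ≟ᴹ (σℤ ⊛ w) ⊛ k⁻¹))

w₄-certificate : DoubleCosetCertificate w₄ℤ k₄ℤ k₄ℤ⁻¹
w₄-certificate = from-yes (doubleCosetCertificate? w₄ℤ k₄ℤ k₄ℤ⁻¹)

w₅-certificate : DoubleCosetCertificate w₅ℤ k₅ℤ k₅ℤ⁻¹
w₅-certificate = from-yes (doubleCosetCertificate? w₅ℤ k₅ℤ k₅ℤ⁻¹)

w₆-certificate : DoubleCosetCertificate w₆ℤ k₆ℤ k₆ℤ⁻¹
w₆-certificate = from-yes (doubleCosetCertificate? w₆ℤ k₆ℤ k₆ℤ⁻¹)

module DoubleCosets (p : ℕ) .{{_ : NonZero p}} where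
  open Padic p
  open PadicRing p
  open PadicMatrices p
  open PadicMatrixGroups p
  open PadicSubgroups p
  open ℚpSolver using (solve; _:=_; _:+_; _:*_; con)

  embed : ∀ {n} → ℤMat n → Mat n
  embed A i j = ⟦ A i j ⟧ℤ

  ∑-embed : ∀ {n} (f : Fin n → ℤ) → ∑ (λ l → ⟦ f l ⟧ℤ) ≃ ⟦ ∑ℤ f ⟧ℤ
  ∑-embed {zero} f = ≃-refl
  ∑-embed {suc n} f = ≃-trans (⊕-cong (≃-refl {⟦ f zero ⟧ℤ}) (∑-embed (λ i → f (suc i))))
    (≃-sym (⟦⟧ℤ-homo-+ (f zero) (∑ℤ (λ i → f (suc i)))))

  embed-⊛ : ∀ {n} (A B : ℤMat n) → embed A ⋆ embed B ≃M embed (A ⊛ B)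
  embed-⊛ A B i j = ≃-trans (∑-cong (λ l → ≃-sym (⟦⟧ℤ-homo-* (A i l) (B l j)))) (∑-embed (λ l → A i l ℤ.* B l j))

  embed-cong : ∀ {n} {A B : ℤMat n} → A ≡ᴹ B → embed A ≃M embed B
  embed-cong e i j = ≡⇒≃ (cong ⟦_⟧ℤ (e i j))

  kronecker≡δ : ∀ {n} (i j : Fin n) → kronecker i j ≡ δ i j
  kronecker≡δ zero zero = refl
  kronecker≡δ zero (suc j) = refl
  kronecker≡δ (suc i) zero = refl
  kronecker≡δ (suc i) (suc j) = kronecker≡δ i j

  embed-1ℤ : ∀ {n} → embed {n} 1ℤ ≃M I
  embed-1ℤ i j = ≡⇒≃ (cong ℕq (kronecker≡δ i j))

  embed-inverse : ∀ {n} (A B : ℤMat n) → A ⊛ B ≡ᴹ 1ℤ → embed A ⋆ embed B ≃M I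
  embed-inverse A B e = ≃M-trans (embed-⊛ A B) (≃M-trans (embed-cong {A = A ⊛ B} e) embed-1ℤ)

  embed-⊛⊛ : ∀ {n} (X A B C : ℤMat n) → X ≡ᴹ (A ⊛ B) ⊛ C → embed X ≃M (embed A ⋆ embed B) ⋆ embed C
  embed-⊛⊛ X A B C e = ≃M-trans (embed-cong {A = X} e)
    (≃M-sym (≃M-trans (⋆-congʳ (embed C) (embed-⊛ A B)) (embed-⊛ (A ⊛ B) C)))

  embed-IntegrallyInvertible : ∀ {n} (A B : ℤMat n) → A ⊛ B ≡ᴹ 1ℤ → B ⊛ A ≡ᴹ 1ℤ → IntegrallyInvertible (embed A)
  embed-IntegrallyInvertible A B AB BA =
    (λ i j → ⟦⟧ℤ-integral (A i j)) , embed B , (λ i j → ⟦⟧ℤ-integral (B i j)) , embed-inverse A B AB , embed-inverse B A BA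
    where
    ⟦⟧ℤ-integral : ∀ i → IsIntegral ⟦ i ⟧ℤ
    ⟦⟧ℤ-integral (+ n) = IsIntegral-ℕq n
    ⟦⟧ℤ-integral -[1+ n ] = IsIntegral-⊝ (IsIntegral-ℕq (suc n))

  embed-IsMirahoric : ∀ m (A B : ℤMat 4) → A ⊛ B ≡ᴹ 1ℤ → B ⊛ A ≡ᴹ 1ℤ → LastRowStandard A →
                      IsMirahoric m (embed A)
  embed-IsMirahoric m A B AB BA lastRow = embed-IntegrallyInvertible A B AB BA , congruent
    where
    congruent : RowCongruent m (# 3) (embed A)
    congruent j = 0q , IsIntegral-ℕq 0 , ≃-trans (≡⇒≃ (cong ⟦_⟧ℤ (lastRow j)))
      (≃-trans (≡⇒≃ (cong ℕq (kronecker≡δ (# 3) j))) (plus-zero _ _))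
      where
      plus-zero : ∀ c P → c ≃ c ⊕ P ⊗ 0q
      plus-zero = solve 2 (λ c P → c := c :+ P :* con (+ 0)) ≃-refl

  σ-IsParabolic : IsParabolic (embed σℤ)
  σ-IsParabolic = IntegrallyInvertible⇒Invertible {g = embed σℤ} (embed-IntegrallyInvertible σℤ σℤ σσ≡1 σσ≡1) ,
                  (λ i j → ≡⇒≃ (cong ⟦_⟧ℤ (σ-blockUpper i j)))

  samePwK : ∀ m w k k⁻¹ → DoubleCosetCertificate w k k⁻¹ →
            ∀ g → InDoubleCoset m (embed w) g ⇔ InDoubleCoset m (embed ξℤ) g
  samePwK m w k k⁻¹ ((kk⁻¹ , k⁻¹k) , (k-row , k⁻¹-row) , w≡σξk , ξ≡σwk⁻¹) g = mk⇔
    (λ g∈PwK → InPwK⇒InDoubleCoset {m} {embed ξℤ} {g}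
      (InPwK-⊆ {m} {embed w} {embed ξℤ} {embed σℤ} {embed k} σ-IsParabolic
        (embed-IsMirahoric m k k⁻¹ kk⁻¹ k⁻¹k k-row) (embed-⊛⊛ w σℤ ξℤ k w≡σξk) (InDoubleCoset⇒InPwK {m} {embed w} {g} g∈PwK)))
    (λ g∈PξK → InPwK⇒InDoubleCoset {m} {embed w} {g}
      (InPwK-⊆ {m} {embed ξℤ} {embed w} {embed σℤ} {embed k⁻¹} σ-IsParabolic
        (embed-IsMirahoric m k⁻¹ k k⁻¹k kk⁻¹ k⁻¹-row) (embed-⊛⊛ ξℤ σℤ w k⁻¹ ξ≡σwk⁻¹) (InDoubleCoset⇒InPwK {m} {embed ξℤ} {g} g∈PξK)))

  doubleCosets-coincide : ∀ m →
    (∀ g → InDoubleCoset m w₄ g ⇔ InDoubleCoset m ξ₀ g) ×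
    (∀ g → InDoubleCoset m w₅ g ⇔ InDoubleCoset m ξ₀ g) ×
    (∀ g → InDoubleCoset m w₆ g ⇔ InDoubleCoset m ξ₀ g)
  doubleCosets-coincide m = 
    samePwK m w₄ℤ k₄ℤ k₄ℤ⁻¹ w₄-certificate ,
    samePwK m w₅ℤ k₅ℤ k₅ℤ⁻¹ w₅-certificate ,
    samePwK m w₆ℤ k₆ℤ k₆ℤ⁻¹ w₆-certificate

module LeviImage (p : ℕ) .{{_ : NonZero p}} where
  open Padic p
  open PadicRing p
  open PadicMatrices p
  open PadicMatrixGroups p
  open PadicBlockMatrices p
  open PadicSubgroups p
  open DoubleCosets p
  open ℚpSolver using (prove; solve; _:=_; con; var; _:+_; _:*_; :-_; _:-_; Polynomial)
  open SetoidReasoning setoid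

  ∑ᴾ : ∀ {k n} → (Fin k → Polynomial n) → Polynomial n
  ∑ᴾ {zero} f = con (+ 0)
  ∑ᴾ {suc k} f = f zero :+ ∑ᴾ (λ i → f (suc i))

  infixl 7 _⋆ᴾ_
  _⋆ᴾ_ : ∀ {k n} → (Fin k → Fin k → Polynomial n) → (Fin k → Fin k → Polynomial n) → Fin k → Fin k → Polynomial n
  (X ⋆ᴾ Y) i j = ∑ᴾ (λ l → X i l :* Y l j)

  ξ ξ⁻¹ : Mat 4
  ξ = embed ξℤ
  ξ⁻¹ = embed ξℤ⁻¹

  conj : Mat 4 → Mat 4
  conj X = (ξ⁻¹ ⋆ X) ⋆ ξ

  -- Left multiplication by ξ⁻¹ subtracts row 1 from row 3; right multiplication by ξ adds column 3 to column 1.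
  module LastRowOfConj (X : Mat 4) where
    private
      ρ : Vec ℚp 16
      ρ = X (# 0) (# 0) ∷ X (# 0) (# 1) ∷ X (# 0) (# 2) ∷ X (# 0) (# 3) ∷
          X (# 1) (# 0) ∷ X (# 1) (# 1) ∷ X (# 1) (# 2) ∷ X (# 1) (# 3) ∷
          X (# 2) (# 0) ∷ X (# 2) (# 1) ∷ X (# 2) (# 2) ∷ X (# 2) (# 3) ∷
          X (# 3) (# 0) ∷ X (# 3) (# 1) ∷ X (# 3) (# 2) ∷ X (# 3) (# 3) ∷ []
      x : Fin 4 → Fin 4 → Polynomial 16
      x zero j = var (j ↑ˡ 12)
      x (suc zero) j = var (4 ↑ʳ (j ↑ˡ 8))
      x (suc (suc zero)) j = var (8 ↑ʳ (j ↑ˡ 4))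
      x (suc (suc (suc zero))) j = var (12 ↑ʳ j)
      conjᴾ : Fin 4 → Fin 4 → Polynomial 16
      conjᴾ = ((λ i j → con (ξℤ⁻¹ i j)) ⋆ᴾ x) ⋆ᴾ (λ i j → con (ξℤ i j))

    entry₀ : conj X (# 3) (# 0) ≃ X (# 3) (# 0) ⊕ ⊝ X (# 1) (# 0)
    entry₀ = prove ρ (conjᴾ (# 3) (# 0)) (x (# 3) (# 0) :- x (# 1) (# 0)) ≃-refl

    entry₁ : conj X (# 3) (# 1) ≃ (X (# 3) (# 1) ⊕ ⊝ X (# 1) (# 1)) ⊕ (X (# 3) (# 3) ⊕ ⊝ X (# 1) (# 3))
    entry₁ = prove ρ (conjᴾ (# 3) (# 1))
      ((x (# 3) (# 1) :- x (# 1) (# 1)) :+ (x (# 3) (# 3) :- x (# 1) (# 3))) ≃-refl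

    entry₂ : conj X (# 3) (# 2) ≃ X (# 3) (# 2) ⊕ ⊝ X (# 1) (# 2)
    entry₂ = prove ρ (conjᴾ (# 3) (# 2)) (x (# 3) (# 2) :- x (# 1) (# 2)) ≃-refl

    entry₃ : conj X (# 3) (# 3) ≃ X (# 3) (# 3) ⊕ ⊝ X (# 1) (# 3)
    entry₃ = prove ρ (conjᴾ (# 3) (# 3)) (x (# 3) (# 3) :- x (# 1) (# 3)) ≃-refl

    row₁-entry₀ : X (# 1) (# 0) ≃ X (# 3) (# 0) ⊕ ⊝ conj X (# 3) (# 0)
    row₁-entry₀ = ≃-trans (solve 2 (λ a b → b := a :- (a :- b)) ≃-refl (X (# 3) (# 0)) (X (# 1) (# 0)))
      (⊕-cong ≃-refl (⊝-cong (≃-sym entry₀)))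

    row₁-entry₁ : X (# 1) (# 1) ≃ X (# 3) (# 1) ⊕ (conj X (# 3) (# 3) ⊕ ⊝ conj X (# 3) (# 1))
    row₁-entry₁ = ≃-trans
      (solve 4 (λ a b c d → b := a :+ ((c :- d) :- ((a :- b) :+ (c :- d)))) ≃-refl
        (X (# 3) (# 1)) (X (# 1) (# 1)) (X (# 3) (# 3)) (X (# 1) (# 3)))
      (⊕-cong ≃-refl (⊕-cong (≃-sym entry₃) (⊝-cong (≃-sym entry₁))))

  -- With H = L A − I:  A L − I = det L · A H (adj A) − ε (A L − I), where ε = det (I + H) − 1;
  -- every term on the right carries an entry of H, so L A = I forces A L = I.
  module LeftInverse₂ (A L : Mat 2) where
    private
      ρ : Vec ℚp 8
      ρ = A (# 0) (# 0) ∷ A (# 0) (# 1) ∷ A (# 1) (# 0) ∷ A (# 1) (# 1) ∷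
          L (# 0) (# 0) ∷ L (# 0) (# 1) ∷ L (# 1) (# 0) ∷ L (# 1) (# 1) ∷ []
      a l : Fin 2 → Fin 2 → Polynomial 8
      a zero j = var (j ↑ˡ 6)
      a (suc zero) j = var (2 ↑ʳ (j ↑ˡ 4))
      l zero j = var (4 ↑ʳ (j ↑ˡ 2))
      l (suc zero) j = var (6 ↑ʳ j)
      δᴾ h adj : Fin 2 → Fin 2 → Polynomial 8
      δᴾ i j = con (+ δ i j)
      h i j = (l ⋆ᴾ a) i j :- δᴾ i j
      adj zero zero = a (# 1) (# 1)
      adj zero (suc zero) = :- a (# 0) (# 1)
      adj (suc zero) zero = :- a (# 1) (# 0)
      adj (suc zero) (suc zero) = a (# 0) (# 0)
      det-l : Polynomial 8
      det-l = l (# 0) (# 0) :* l (# 1) (# 1) :- l (# 0) (# 1) :* l (# 1) (# 0)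
      coefficient : Fin 2 → Fin 2 → Fin 2 → Fin 2 → Polynomial 8
      coefficient i j k m = det-l :* (a i k :* adj m j) :+ ε-part k m
        where
        g : Polynomial 8
        g = (a ⋆ᴾ l) i j :- δᴾ i j
        ε-part : Fin 2 → Fin 2 → Polynomial 8
        ε-part zero zero = :- (g :* (con (+ 1) :+ h (# 1) (# 1)))
        ε-part zero (suc zero) = g :* h (# 1) (# 0)
        ε-part (suc zero) zero = con (+ 0)
        ε-part (suc zero) (suc zero) = :- g
      certificate : Fin 2 → Fin 2 → Polynomial 8
      certificate i j = δᴾ i j :+ ∑ᴾ (λ k → ∑ᴾ (λ m → coefficient i j k m :* h k m))
      identity : ∀ i j → (A ⋆ L) i j ≃ ℚpSolver.⟦ certificate i j ⟧ ρ
      identity zero zero = prove ρ ((a ⋆ᴾ l) (# 0) (# 0)) (certificate (# 0) (# 0)) ≃-refl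
      identity zero (suc zero) = prove ρ ((a ⋆ᴾ l) (# 0) (# 1)) (certificate (# 0) (# 1)) ≃-refl
      identity (suc zero) zero = prove ρ ((a ⋆ᴾ l) (# 1) (# 0)) (certificate (# 1) (# 0)) ≃-refl
      identity (suc zero) (suc zero) = prove ρ ((a ⋆ᴾ l) (# 1) (# 1)) (certificate (# 1) (# 1)) ≃-refl

    rightInverse : L ⋆ A ≃M I → A ⋆ L ≃M I
    rightInverse LA i j =
      ≃-trans (identity i j) (≃-trans (⊕-cong ≃-refl (vanishes (λ k m → ℚpSolver.⟦ coefficient i j k m ⟧ ρ))) (+-identityʳ _))
      where
      vanishes : ∀ (c : Fin 2 → Fin 2 → ℚp) → ∑ (λ k → ∑ (λ m → c k m ⊗ ((L ⋆ A) k m ⊕ ⊝ I k m))) ≃ 0q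
      vanishes c = ≃-trans (∑-cong (λ k → ≃-trans (∑-cong (λ m →
        ≃-trans (⊗-cong ≃-refl (≃-trans (⊕-cong (LA k m) ≃-refl) (⊕-inverseʳ (I k m)))) (zeroʳ (c k m)))) (∑-zero 2))) (∑-zero 2)

  ξξ⁻¹≃I : ξ ⋆ ξ⁻¹ ≃M I
  ξξ⁻¹≃I = embed-inverse ξℤ ξℤ⁻¹ ξξ⁻¹≡1

  ξ⁻¹ξ≃I : ξ⁻¹ ⋆ ξ ≃M I
  ξ⁻¹ξ≃I = embed-inverse ξℤ⁻¹ ξℤ ξ⁻¹ξ≡1

  ξ-IntegrallyInvertible : IntegrallyInvertible ξ
  ξ-IntegrallyInvertible = embed-IntegrallyInvertible ξℤ ξℤ⁻¹ ξξ⁻¹≡1 ξ⁻¹ξ≡1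

  ξ⁻¹-IntegrallyInvertible : IntegrallyInvertible ξ⁻¹
  ξ⁻¹-IntegrallyInvertible = embed-IntegrallyInvertible ξℤ⁻¹ ξℤ ξ⁻¹ξ≡1 ξξ⁻¹≡1

  cancelˡ : ∀ {g h k : Mat 4} → g ⋆ h ≃M I → g ⋆ (h ⋆ k) ≃M k
  cancelˡ {g} {h} {k} gh = ≃M-trans (≃M-sym (⋆-assoc g h k)) (≃M-trans (⋆-congʳ k gh) (⋆-identityˡ k))

  cancelʳ : ∀ {g h k : Mat 4} → h ⋆ k ≃M I → (g ⋆ h) ⋆ k ≃M g
  cancelʳ {g} {h} {k} hk = ≃M-trans (⋆-assoc g h k) (≃M-trans (⋆-congˡ g hk) (⋆-identityʳ g))

  conj-intertwines : ∀ q → q ⋆ ξ ≃M ξ ⋆ conj q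
  conj-intertwines q = ≃M-sym (≃M-trans (≃M-sym (⋆-assoc ξ (ξ⁻¹ ⋆ q) ξ)) (⋆-congʳ ξ (cancelˡ {ξ} {ξ⁻¹} {q} ξξ⁻¹≃I)))

  intertwiner≃conj : ∀ {q k} → q ⋆ ξ ≃M ξ ⋆ k → k ≃M conj q
  intertwiner≃conj {q} {k} e = ≃M-sym (≃M-trans (⋆-assoc ξ⁻¹ q ξ)
    (≃M-trans (⋆-congˡ ξ⁻¹ e) (cancelˡ {ξ⁻¹} {ξ} {k} ξ⁻¹ξ≃I)))

  intertwiner-unconj : ∀ {q k} → q ⋆ ξ ≃M ξ ⋆ k → q ≃M (ξ ⋆ k) ⋆ ξ⁻¹
  intertwiner-unconj {q} {k} e = ≃M-trans (≃M-sym (cancelʳ {q} {ξ} {ξ⁻¹} ξξ⁻¹≃I)) (⋆-congʳ ξ⁻¹ e)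

  leviBlocks-IntegrallyInvertible : ∀ {q : Mat 4} → IntegrallyInvertible q → BlockUpper {2} q →
                                    IntegrallyInvertible (κA q) × IntegrallyInvertible (κD q)
  leviBlocks-IntegrallyInvertible {q} (iq , r , ir , qr , rq) q₀ =
    ((λ i j → iq (i ↑ˡ 2) (j ↑ˡ 2)) , κA r , (λ i j → ir (i ↑ˡ 2) (j ↑ˡ 2)) ,
      LeftInverse₂.rightInverse (κA q) (κA r) rAqA , rAqA) ,
    ((λ i j → iq (2 ↑ʳ i) (2 ↑ʳ j)) , κD r , (λ i j → ir (2 ↑ʳ i) (2 ↑ʳ j)) ,
      qDrD , LeftInverse₂.rightInverse (κD r) (κD q) qDrD)
    where
    rAqA : κA r ⋆ κA q ≃M I
    rAqA = ≃M-trans (≃M-sym (topLeft-⋆-BlockUpper {2} {r} {q} q₀)) (≃M-trans (λ i j → rq (i ↑ˡ 2) (j ↑ˡ 2)) topLeft-I)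
    qDrD : κD q ⋆ κD r ≃M I
    qDrD = ≃M-trans (≃M-sym (bottomRight-⋆-BlockUpper {2} {q} {r} q₀))
      (≃M-trans (λ i j → qr (2 ↑ʳ i) (2 ↑ʳ j)) bottomRight-I)

  conj-congruences : ∀ m {q k : Mat 4} → BlockUpper {2} q → RowCongruent m (# 3) k → k ≃M conj q →
                     Congruent m (q (# 1) (# 0)) 0 × Congruent m (q (# 1) (# 1)) 1
  conj-congruences m {q} {k} q₀ k-row k≃conj =
    (⊝ y₀ , IsIntegral-⊝ iy₀ , (begin
      q (# 1) (# 0)                                  ≈⟨ row₁-entry₀ ⟩
      q (# 3) (# 0) ⊕ ⊝ conj q (# 3) (# 0)           ≈⟨ ⊕-cong (q₀ (# 1) (# 0)) (⊝-cong (≃-trans (≃-sym (k≃conj (# 3) (# 0))) ey₀)) ⟩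
      0q ⊕ ⊝ (ℕq 0 ⊕ P ⊗ y₀)                         ≈⟨ solve 2 (λ P y → con (+ 0) :- (con (+ 0) :+ P :* y) := con (+ 0) :+ P :* (:- y)) ≃-refl P y₀ ⟩
      ℕq 0 ⊕ P ⊗ ⊝ y₀                                ∎)) ,
    (y₃ ⊕ ⊝ y₁ , IsIntegral-⊕ iy₃ (IsIntegral-⊝ iy₁) , (begin
      q (# 1) (# 1)                                                 ≈⟨ row₁-entry₁ ⟩
      q (# 3) (# 1) ⊕ (conj q (# 3) (# 3) ⊕ ⊝ conj q (# 3) (# 1))   ≈⟨ ⊕-cong (q₀ (# 1) (# 1)) (⊕-cong
                                                                          (≃-trans (≃-sym (k≃conj (# 3) (# 3))) ey₃)
                                                                          (⊝-cong (≃-trans (≃-sym (k≃conj (# 3) (# 1))) ey₁))) ⟩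
      0q ⊕ ((ℕq 1 ⊕ P ⊗ y₃) ⊕ ⊝ (ℕq 0 ⊕ P ⊗ y₁))                   ≈⟨ solve 3 (λ P y₁ y₃ → con (+ 0) :+ ((con (+ 1) :+ P :* y₃) :- (con (+ 0) :+ P :* y₁))
                                                                                          := con (+ 1) :+ P :* (y₃ :- y₁)) ≃-refl P y₁ y₃ ⟩
      ℕq 1 ⊕ P ⊗ (y₃ ⊕ ⊝ y₁)                                        ∎))
    where
    open LastRowOfConj q
    P = ℕq (p ^ m)
    y₀ = proj₁ (k-row (# 0))
    iy₀ = proj₁ (proj₂ (k-row (# 0)))
    ey₀ = proj₂ (proj₂ (k-row (# 0)))
    y₁ = proj₁ (k-row (# 1))
    iy₁ = proj₁ (proj₂ (k-row (# 1)))
    ey₁ = proj₂ (proj₂ (k-row (# 1)))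
    y₃ = proj₁ (k-row (# 3))
    iy₃ = proj₁ (proj₂ (k-row (# 3)))
    ey₃ = proj₂ (proj₂ (k-row (# 3)))

  Congruent-resp-≃ : ∀ {m x y c} → x ≃ y → Congruent m y c → Congruent m x c
  Congruent-resp-≃ x≃y (z , iz , e) = z , iz , ≃-trans x≃y e

  ≈M⇒≃M : ∀ {n} {g h : Mat n} → g ≈M h → g ≃M h
  ≈M⇒≃M {g = g} e i j = ⟨_⟩ {g i j} (e i j)

  leviImage-⊆ : ∀ m (A D : Mat 2) →
    (∃ λ (q : Mat 4) → Parabolic q × InConj m ξ₀ q × κA q ≈M A × κD q ≈M D) → K2 m A × GLℤ D
  leviImage-⊆ m A D (q , pq , (k , mk , qξ≈ξk) , qA≈A , qD≈D) =
    ( IntegrallyInvertible⇒GLℤ {g = A} (IntegrallyInvertible-resp-≃M qA≃A (proj₁ levi))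
    , Congruent⇒Cong {m} {A (# 1) (# 0)} (Congruent-resp-≃ {m} (≃-sym (qA≃A (# 1) (# 0))) (proj₁ congruences))
    , Congruent⇒Cong {m} {A (# 1) (# 1)} (Congruent-resp-≃ {m} (≃-sym (qA≃A (# 1) (# 1))) (proj₂ congruences)))
    , IntegrallyInvertible⇒GLℤ {g = D} (IntegrallyInvertible-resp-≃M qD≃D (proj₂ levi))
    where
    qA≃A : κA q ≃M A
    qA≃A = ≈M⇒≃M {g = κA q} {A} qA≈A
    qD≃D : κD q ≃M D
    qD≃D = ≈M⇒≃M {g = κD q} {D} qD≈D
    q-upper : BlockUpper {2} q
    q-upper = proj₂ (Parabolic⇒IsParabolic {q} pq)
    k-mirahoric : IsMirahoric m k
    k-mirahoric = Mirahoric⇒IsMirahoric {m} {k} mk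
    intertwines : q ⋆ ξ ≃M ξ ⋆ k
    intertwines = ≃M-trans (≃M-sym (·≃⋆ q ξ)) (≃M-trans (≈M⇒≃M {g = q · ξ} {ξ · k} qξ≈ξk) (·≃⋆ ξ k))
    q-integral : IntegrallyInvertible q
    q-integral = IntegrallyInvertible-resp-≃M (≃M-sym (intertwiner-unconj {q} {k} intertwines))
      (IntegrallyInvertible-⋆ {g = ξ ⋆ k} {ξ⁻¹}
        (IntegrallyInvertible-⋆ {g = ξ} {k} ξ-IntegrallyInvertible (proj₁ k-mirahoric)) ξ⁻¹-IntegrallyInvertible)
    levi : IntegrallyInvertible (κA q) × IntegrallyInvertible (κD q)
    levi = leviBlocks-IntegrallyInvertible {q} q-integral q-upper
    congruences : Congruent m (q (# 1) (# 0)) 0 × Congruent m (q (# 1) (# 1)) 1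
    congruences = conj-congruences m {q} {k} q-upper (proj₂ k-mirahoric) (intertwiner≃conj {q} {k} intertwines)

  IntegralMat-blockwise : ∀ {n} {g : Mat (n + n)} →
    IntegralMat (topLeft {n} g) → IntegralMat (topRight {n} g) →
    IntegralMat (bottomLeft {n} g) → IntegralMat (bottomRight {n} g) → IntegralMat g
  IntegralMat-blockwise {n} tl tr bl br =
    ↑-elim n n (λ i → ↑-elim n n (tl i) (tr i)) (λ i → ↑-elim n n (bl i) (br i))

  IntegralMat-blockMat : ∀ {n} {A B C D : Mat n} →
    IntegralMat A → IntegralMat B → IntegralMat C → IntegralMat D → IntegralMat (blockMat A B C D)
  IntegralMat-blockMat {n} {A} {B} {C} {D} iA iB iC iD = IntegralMat-blockwise {n}
    (λ i j → IsIntegral-resp-≃ (topLeft-blockMat A B C D i j) (iA i j))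
    (λ i j → IsIntegral-resp-≃ (topRight-blockMat A B C D i j) (iB i j))
    (λ i j → IsIntegral-resp-≃ (bottomLeft-blockMat A B C D i j) (iC i j))
    (λ i j → IsIntegral-resp-≃ (bottomRight-blockMat A B C D i j) (iD i j))

  -- The second row of B makes the last row of ξ⁻¹ q ξ equal to (− A₁₀ , 1 − A₁₁ , 0 , 1).
  module LeviLift (A D : Mat 2) where
    B : Mat 2
    B zero j = 0q
    B (suc zero) zero = D (# 1) (# 0)
    B (suc zero) (suc zero) = D (# 1) (# 1) ⊕ ⊝ 1q

    q : Mat 4
    q = blockMat A B 𝟘 D

    q-upper : BlockUpper {2} q
    q-upper = bottomLeft-blockMat A B 𝟘 D

    q-IntegrallyInvertible : IntegrallyInvertible A → IntegrallyInvertible D → IntegrallyInvertible q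
    q-IntegrallyInvertible (iA , A′ , iA′ , AA′ , A′A) (iD , D′ , iD′ , DD′ , D′D) =
      IntegralMat-blockMat {2} {A} {B} {𝟘} {D} iA iB i𝟘 iD , q⁻¹ ,
      IntegralMat-blockMat {2} {A′} {N} {𝟘} {D′} iA′ iN i𝟘 iD′ , inverseʳ AA′ DD′ , inverseˡ A′A D′D
      where
      open BlockUpperInverse A A′ B D D′
      iB : IntegralMat B
      iB zero j = IsIntegral-ℕq 0
      iB (suc zero) zero = iD (# 1) (# 0)
      iB (suc zero) (suc zero) = IsIntegral-⊕ (iD (# 1) (# 1)) (IsIntegral-⊝ (IsIntegral-ℕq 1))
      i𝟘 : IntegralMat {2} 𝟘
      i𝟘 i j = IsIntegral-ℕq 0
      iN : IntegralMat N
      iN i j = IsIntegral-⊝ (IntegralMat-⋆ {g = A′} iA′ (IntegralMat-⋆ {g = B} iB iD′) i j)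

    conj-q-lastRow : ∀ m → Congruent m (A (# 1) (# 0)) 0 → Congruent m (A (# 1) (# 1)) 1 →
                     RowCongruent m (# 3) (conj q)
    conj-q-lastRow m (y , iy , ey) (y′ , iy′ , ey′) zero = ⊝ y , IsIntegral-⊝ iy , (begin
      conj q (# 3) (# 0)        ≈⟨ entry₀ ⟩
      0q ⊕ ⊝ A (# 1) (# 0)      ≈⟨ ⊕-cong ≃-refl (⊝-cong ey) ⟩
      0q ⊕ ⊝ (ℕq 0 ⊕ P ⊗ y)     ≈⟨ solve 2 (λ P y → con (+ 0) :- (con (+ 0) :+ P :* y) := con (+ 0) :+ P :* (:- y)) ≃-refl P y ⟩
      ℕq 0 ⊕ P ⊗ ⊝ y            ∎)
      where
      open LastRowOfConj q
      P = ℕq (p ^ m)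
    conj-q-lastRow m (y , iy , ey) (y′ , iy′ , ey′) (suc zero) = ⊝ y′ , IsIntegral-⊝ iy′ , (begin
      conj q (# 3) (# 1)                                              ≈⟨ entry₁ ⟩
      (0q ⊕ ⊝ A (# 1) (# 1)) ⊕ (d ⊕ ⊝ (d ⊕ ⊝ 1q))                     ≈⟨ ⊕-cong (⊕-cong ≃-refl (⊝-cong ey′)) ≃-refl ⟩
      (0q ⊕ ⊝ (ℕq 1 ⊕ P ⊗ y′)) ⊕ (d ⊕ ⊝ (d ⊕ ⊝ 1q))                   ≈⟨ solve 3 (λ P y d → (con (+ 0) :- (con (+ 1) :+ P :* y)) :+ (d :- (d :- con (+ 1)))
                                                                                        := con (+ 0) :+ P :* (:- y)) ≃-refl P y′ d ⟩
      ℕq 0 ⊕ P ⊗ ⊝ y′                                                 ∎)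
      where
      open LastRowOfConj q
      P = ℕq (p ^ m)
      d = D (# 1) (# 1)
    conj-q-lastRow m _ _ (suc (suc zero)) = 0q , IsIntegral-ℕq 0 ,
      ≃-trans entry₂ (solve 2 (λ P d → d :- d := con (+ 0) :+ P :* con (+ 0)) ≃-refl (ℕq (p ^ m)) (D (# 1) (# 0)))
      where open LastRowOfConj q
    conj-q-lastRow m _ _ (suc (suc (suc zero))) = 0q , IsIntegral-ℕq 0 ,
      ≃-trans entry₃ (solve 2 (λ P d → d :- (d :- con (+ 1)) := con (+ 1) :+ P :* con (+ 0)) ≃-refl (ℕq (p ^ m)) (D (# 1) (# 1)))
      where open LastRowOfConj q

  leviImage-⊇ : ∀ m (A D : Mat 2) → K2 m A × GLℤ D →
    ∃ λ (q : Mat 4) → Parabolic q × InConj m ξ₀ q × κA q ≈M A × κD q ≈M D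
  leviImage-⊇ m A D ((gA , cA₁₀ , cA₁₁) , gD) =
    q , IsParabolic⇒Parabolic {q} (IntegrallyInvertible⇒Invertible {g = q} q-integral , q-upper) ,
    (conj q , IsMirahoric⇒Mirahoric {m} {conj q} (k-integral , k-row) , intertwines) ,
    (λ i j → ≃⇒≈ (topLeft-blockMat A B 𝟘 D i j)) , (λ i j → ≃⇒≈ (bottomRight-blockMat A B 𝟘 D i j))
    where
    open LeviLift A D
    q-integral : IntegrallyInvertible q
    q-integral = q-IntegrallyInvertible (GLℤ⇒IntegrallyInvertible {g = A} gA) (GLℤ⇒IntegrallyInvertible {g = D} gD)
    k-integral : IntegrallyInvertible (conj q)
    k-integral = IntegrallyInvertible-⋆ {g = ξ⁻¹ ⋆ q} {ξ}
      (IntegrallyInvertible-⋆ {g = ξ⁻¹} {q} ξ⁻¹-IntegrallyInvertible q-integral) ξ-IntegrallyInvertible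
    k-row : RowCongruent m (# 3) (conj q)
    k-row = conj-q-lastRow m (Cong⇒Congruent {m} {A (# 1) (# 0)} cA₁₀) (Cong⇒Congruent {m} {A (# 1) (# 1)} cA₁₁)
    intertwines : (q · ξ₀) ≈M (ξ₀ · conj q)
    intertwines i j = ≃⇒≈ (≃M-trans (·≃⋆ q ξ) (≃M-trans (conj-intertwines q) (≃M-sym (·≃⋆ ξ (conj q)))) i j)

  leviImage : ∀ m (A D : Mat 2) →
    (∃ λ (q : Mat 4) → Parabolic q × InConj m ξ₀ q × κA q ≈M A × κD q ≈M D) ⇔ (K2 m A × GLℤ D)
  leviImage m A D = mk⇔ (leviImage-⊆ m A D) (leviImage-⊇ m A D)

mainTheorem7 : (p : ℕ) .{{_ : NonZero p}} → Prime p → (n n′ : ℕ) →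
    let open Padic p in
    ((∀ g → InDoubleCoset (n + n′) w₄ g ⇔ InDoubleCoset (n + n′) ξ₀ g)
      × (∀ g → InDoubleCoset (n + n′) w₅ g ⇔ InDoubleCoset (n + n′) ξ₀ g)
      × (∀ g → InDoubleCoset (n + n′) w₆ g ⇔ InDoubleCoset (n + n′) ξ₀ g))
    × (∀ (A D : Mat 2) →
        (∃ λ (q : Mat 4) → Parabolic q × InConj (n + n′) ξ₀ q × κA q ≈M A × κD q ≈M D)
        ⇔ (K2 (n + n′) A × GLℤ D))
mainTheorem7 p _ n n′ = DoubleCosets.doubleCosets-coincide p (n + n′) , LeviImage.leviImage p (n + n′)
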